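{- Let $T$ be a $[2]$-trade of volume $6$ which, as an element of the group ring $\mathbb Z[2^V]$, is represented as $$T=(1-Y_1)(1-Y_2)(1-Y_3)-(1-Z_1)(1-Z_2)(1-Z_3),$$ where $Y_1,Y_2,Y_3$ are mutually disjoint nonempty sets, $Z_1,Z_2,Z_3$ are mutually disjoint nonempty sets, $Y_1,Y_2,Y_3,Z_1,Z_2,Z_3$ are mutually different, and $Y_1Y_2=Z_1Z_2$. Then every extension $T'$ of $T$ is a shift of a $[2]$-trade of the same form, i.e. there is $W\subseteq V$ with $WT'=(1-Y'_1)(1-Y'_2)(1-Y'_3)-(1-Z'_1)(1-Z'_2)(1-Z'_3)$ for sets $Y'_i,Z'_i$ satisfying the same conditions.
   Context: Let $V$ be a finite set. Subsets of $V$ form a group under symmetric difference $\oplus$, and we work in the group ring $\mathbb Z[(2^V,\oplus)]$: juxtaposition $XY$ of sets denotes $X\oplus Y$, $1$ denotes the empty set, and $x_i=\{i\}$. A pair $T=(T_+,T_-)$ of disjoint finite multisets of subsets (blocks) is identified with $\sum_X\tau_X X$, where $\tau_X$ is the multiplicity of $X$ in $T_+$, or minus its multiplicity in $T_-$. $T$ is a $[t]$-trade if for each $i\le t$ every $i$-subset of $V$ lies in equally many blocks of $T_+$ as of $T_-$; its volume is $|T_+|=|T_-|$. The $Y$-shift of $T$ is $YT$. If $T'=P+x_sP'$ with $s$ not occurring in blocks of $P,P'$, its $s$-projection is $P+P'$; $T'$ is an extension of a $[t]$-trade $T$ if $T'$ is a $[t]$-trade, $T$ is the $s$-projection of $T'$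 for some $s$ not in any block of $T$, and $\mathrm{vol}(T')=\mathrm{vol}(T)$. -}

module Defs where

open import Data.Nat as ℕ using (ℕ; zero; suc)
open import Data.Integer as ℤ using (ℤ; +_; -[1+_])
open import Data.Bool using (Bool; true; false; _xor_)
open import Data.Bool.Properties using () renaming (_≟_ to _≟ᵇ_)
open import Data.Fin using (Fin)
open import Data.Fin.Subset using (Subset; outside; inside; _⊆_; _∈_; _∩_; ∣_∣; Nonempty)
  renaming (⊥ to ∅)
open import Data.Fin.Subset.Properties using (_⊆?_)
open import Data.Vec using (Vec; []; _∷_; zipWith)
open import Data.Vec.Properties using (≡-dec)
open import Data.List using (List; []; _∷_; _++_; map; foldr)
open import Data.Product using (Σ; _×_; ∃; ∃-syntax; _,_)
open import Relation.Nullary using (¬_; yes; no)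
open import Relation.Nullary.Decidable using (Dec)
open import Relation.Binary.PropositionalEquality using (_≡_)

_≟ₛ_ : ∀ {n} (X Y : Subset n) → Dec (X ≡ Y)
_≟ₛ_ = ≡-dec _≟ᵇ_

-- Symmetric difference (the group operation on 2^V)
_⊕_ : ∀ {n} → Subset n → Subset n → Subset n
_⊕_ = zipWith _xor_

x[_] : ∀ {n} → Fin n → Subset n
x[ i ] = Data.Fin.Subset.⁅ i ⁆

allSubsets : (n : ℕ) → List (Subset n)
allSubsets zero    = [] ∷ []
allSubsets (suc n) = map (outside ∷_) (allSubsets n) ++ map (inside ∷_) (allSubsets n)

Σℤ : ∀ {n} → (Subset n → ℤ) → ℤ
Σℤ {n} f = foldr (λ X acc → f X ℤ.+ acc) (+ 0) (allSubsets n)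

Σℕ : ∀ {n} → (Subset n → ℕ) → ℕ
Σℕ {n} f = foldr (λ X acc → f X ℕ.+ acc) 0 (allSubsets n)

-- Elements of the group ring ℤ[(2^V, ⊕)], V = Fin n, as coefficient functions
GR : ℕ → Set
GR n = Subset n → ℤ

_≈_ : ∀ {n} → GR n → GR n → Set
f ≈ g = ∀ X → f X ≡ g X

δ : ∀ {n} → Subset n → GR n
δ Y X with X ≟ₛ Y
... | yes _ = + 1
... | no  _ = + 0

𝟙 : ∀ {n} → GR n
𝟙 = δ ∅

_+ᴳ_ : ∀ {n} → GR n → GR n → GR n
(f +ᴳ g) X = f X ℤ.+ g X

_-ᴳ_ : ∀ {n} → GR n → GR n → GR n
(f -ᴳ g) X = f X ℤ.- g X

_*ᴳ_ : ∀ {n} → GR n → GR n → GR n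
(f *ᴳ g) X = Σℤ (λ Y → f Y ℤ.* g (Y ⊕ X))

infixl 7 _*ᴳ_
infixl 6 _+ᴳ_ _-ᴳ_

-- the Y-shift YT (product with the basis element Y)
shift : ∀ {n} → Subset n → GR n → GR n
shift Y T X = T (Y ⊕ X)

-- multiplicity of X in T₊ (positive part) and in T₋ (negative part)
pos : ℤ → ℕ
pos (+ k)    = k
pos -[1+ _ ] = 0

neg : ℤ → ℕ
neg (+ _)    = 0
neg -[1+ k ] = suc k

count₊ : ∀ {n} → GR n → Subset n → ℕ
count₊ T I = Σℕ (λ X → cnt X)
  where
  cnt : _ → ℕ
  cnt X with I ⊆? X
  ... | yes _ = pos (T X)
  ... | no  _ = 0

count₋ : ∀ {n} → GR n → Subset n → ℕ
count₋ T I = Σℕ (λ X → cnt X)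
  where
  cnt : _ → ℕ
  cnt X with I ⊆? X
  ... | yes _ = neg (T X)
  ... | no  _ = 0

IsTrade : ∀ {n} → ℕ → GR n → Set
IsTrade {n} t T = (I : Subset n) → ∣ I ∣ ℕ.≤ t → count₊ T I ≡ count₋ T I

vol : ∀ {n} → GR n → ℕ
vol T = Σℕ (λ X → pos (T X))

Avoids : ∀ {n} → Fin n → GR n → Set
Avoids s P = ∀ X → s ∈ X → P X ≡ + 0

IsProjection : ∀ {n} → Fin n → GR n → GR n → Set
IsProjection {n} s T' T =
  Σ (GR n) λ P → Σ (GR n) λ P' →
    Avoids s P × Avoids s P' × (T' ≈ (P +ᴳ shift x[ s ] P')) × (T ≈ (P +ᴳ P'))

IsExtension : ∀ {n} → ℕ → GR n → GR n → Set
IsExtension t T T' =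
  IsTrade t T' × (∃[ s ] (Avoids s T × IsProjection s T' T)) × (vol T' ≡ vol T)

form : ∀ {n} → (Y₁ Y₂ Y₃ Z₁ Z₂ Z₃ : Subset n) → GR n
form Y₁ Y₂ Y₃ Z₁ Z₂ Z₃ =
  (𝟙 -ᴳ δ Y₁) *ᴳ (𝟙 -ᴳ δ Y₂) *ᴳ (𝟙 -ᴳ δ Y₃) -ᴳ (𝟙 -ᴳ δ Z₁) *ᴳ (𝟙 -ᴳ δ Z₂) *ᴳ (𝟙 -ᴳ δ Z₃)

Disjoint : ∀ {n} → Subset n → Subset n → Set
Disjoint A B = A ∩ B ≡ ∅

FormConditions : ∀ {n} → (Y₁ Y₂ Y₃ Z₁ Z₂ Z₃ : Subset n) → Set
FormConditions Y₁ Y₂ Y₃ Z₁ Z₂ Z₃ =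
  (Disjoint Y₁ Y₂ × Disjoint Y₁ Y₃ × Disjoint Y₂ Y₃) ×
  (Nonempty Y₁ × Nonempty Y₂ × Nonempty Y₃) ×
  (Disjoint Z₁ Z₂ × Disjoint Z₁ Z₃ × Disjoint Z₂ Z₃) ×
  (Nonempty Z₁ × Nonempty Z₂ × Nonempty Z₃) ×
  (¬ Y₁ ≡ Y₂ × ¬ Y₁ ≡ Y₃ × ¬ Y₁ ≡ Z₁ × ¬ Y₁ ≡ Z₂ × ¬ Y₁ ≡ Z₃ ×
   ¬ Y₂ ≡ Y₃ × ¬ Y₂ ≡ Z₁ × ¬ Y₂ ≡ Z₂ × ¬ Y₂ ≡ Z₃ ×
   ¬ Y₃ ≡ Z₁ × ¬ Y₃ ≡ Z₂ × ¬ Y₃ ≡ Z₃ ×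
   ¬ Z₁ ≡ Z₂ × ¬ Z₁ ≡ Z₃ × ¬ Z₂ ≡ Z₃) ×
  (Y₁ ⊕ Y₂ ≡ Z₁ ⊕ Z₂)

module Submission where

-- Write T′ = P + x_s P′.  Equality of volumes forces P and P′ to add without
-- cancellation, so each of the twelve blocks of T (all with coefficient ±1) goes entirely to P or
-- to x_s P′: there are 2¹² splittings.  All sets in play are ⊕-combinations of Y₁, Y₂, Y₃, Z₁, Z₃
-- and {s}, and the disjointness hypotheses leave only a handful of membership patterns (types) for
-- the elements of V.  The [2]-trade condition at a pair {s, i} says that the s-side blocks
-- containing i have coefficient sum 0; every known nonempty set contains an element of one of two
-- types, and this rules out all but 16 splittings.  For each of these an explicit shift W and sets
-- Y′, Z′ are given.

open import Defs
open import Algebra.Bundles using (CommutativeMonoid; CommutativeRing)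
import Algebra.Properties.CommutativeSemigroup as CommutativeSemigroupProperties
open import Data.Bool using (Bool; true; false; T; not; _∧_; _∨_; _xor_; if_then_else_)
open import Data.Bool.ListAction using (any; all)
open import Data.Bool.Properties
  using (∧-conicalˡ; ∧-conicalʳ; ∧-distribʳ-xor; xor-assoc; xor-comm; xor-identityˡ; xor-identityʳ;
         xor-same; xor-∧-commutativeRing; if-eta; T-≡; T-not-≡; T-∧; T-∨)
open import Data.Fin using (Fin; zero; suc)
open import Data.Fin.Subset using (Subset; outside; inside; _∈_; _∩_; _∪_; _⊆_; ⁅_⁆; ∣_∣; Nonempty)
  renaming (⊥ to ∅)
open import Data.Fin.Subset.Properties
  using (_⊆?_; _∈?_; ⊆-min; ∣⊥∣≡0; ∣⁅x⁆∣≡1; x∈⁅x⁆; x∈⁅y⁆⇒x≡y; x∈p∪q⁻; x∈p∪q⁺; ∉⊥)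
open import Data.Integer as ℤ using (ℤ; +_; -[1+_]; _⊖_)
import Data.Integer.Properties as ℤₚ
open import Data.Integer.Tactic.RingSolver using (solve-∀)
open import Data.List using (List; []; _∷_; _++_; map; foldr)
open import Data.List.Membership.Propositional using () renaming (_∈_ to _∈ₗ_; _∉_ to _∉ₗ_)
import Data.List.Membership.DecPropositional as DecMembership
open import Data.List.Membership.Propositional.Properties using (∈-map⁺; ∈-map⁻; ∈-++⁺ˡ; ∈-++⁺ʳ)
open import Data.List.Properties using (map-∘; map-id; map-cong; map-cong-local; map-++)
open import Data.List.Relation.Unary.All using (All; []; _∷_)
import Data.List.Relation.Unary.All as All
open import Data.List.Relation.Unary.All.Properties using (All¬⇒¬Any; all⁺; all⁻)
import Data.List.Relation.Unary.All.Properties as Allₚ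
open import Data.List.Relation.Unary.AllPairs using (AllPairs; []; _∷_; allPairs?)
import Data.List.Relation.Unary.AllPairs as AllPairs
import Data.List.Relation.Unary.AllPairs.Properties as AllPairsₚ
open import Data.List.Relation.Unary.Any using (here; there)
import Data.List.Relation.Unary.Any as Any
open import Data.List.Relation.Unary.Any.Properties using (any⁻)
open import Data.List.Relation.Unary.Unique.Propositional using (Unique)
open import Data.Nat as ℕ using (ℕ; zero; suc; _≤_)
import Data.Nat.Properties as ℕₚ
open import Data.Product using (Σ; _×_; _,_; proj₁; proj₂)
import Data.Product as Product
open import Data.Sum using (_⊎_; inj₁; inj₂)
import Data.Sum as Sum
open import Data.Vec using (Vec; []; _∷_; lookup; here; there)
import Data.Vec as Vec
open import Data.Vec.Properties
  using (zipWith-assoc; zipWith-comm; zipWith-identityˡ; zipWith-identityʳ; lookup-zipWith;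
         lookup-replicate; []=⇒lookup; lookup⇒[]=; tabulate-cong; tabulate∘lookup)
open import Function using (_∘_)
open import Function.Bundles using (Equivalence)
open import Relation.Binary.PropositionalEquality
import Relation.Binary.PropositionalEquality as ≡
open import Relation.Nullary using (¬_; yes; no; does; contradiction)
open import Relation.Nullary.Decidable
  using (Dec; isYes; toWitness; fromWitness; T?; _×-dec_; _⊎-dec_; dec-true; dec-false)

⊕-assoc : ∀ {n} (A B C : Subset n) → (A ⊕ B) ⊕ C ≡ A ⊕ (B ⊕ C)
⊕-assoc = zipWith-assoc xor-assoc

⊕-comm : ∀ {n} (A B : Subset n) → A ⊕ B ≡ B ⊕ A
⊕-comm = zipWith-comm xor-comm

⊕-identityˡ : ∀ {n} (A : Subset n) → ∅ ⊕ A ≡ A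
⊕-identityˡ = zipWith-identityˡ xor-identityˡ

⊕-identityʳ : ∀ {n} (A : Subset n) → A ⊕ ∅ ≡ A
⊕-identityʳ = zipWith-identityʳ xor-identityʳ

⊕-self : ∀ {n} (A : Subset n) → A ⊕ A ≡ ∅
⊕-self []      = refl
⊕-self (a ∷ A) = cong₂ _∷_ (xor-same a) (⊕-self A)

⊕-cancelˡ : ∀ {n} (A X : Subset n) → A ⊕ (A ⊕ X) ≡ X
⊕-cancelˡ A X = begin
  A ⊕ (A ⊕ X)  ≡⟨ ⊕-assoc A A X ⟨
  (A ⊕ A) ⊕ X  ≡⟨ cong (_⊕ X) (⊕-self A) ⟩
  ∅ ⊕ X        ≡⟨ ⊕-identityˡ X ⟩
  X            ∎
  where open ≡-Reasoning

⊕-transpose : ∀ {n} {A B C D : Subset n} → A ⊕ B ≡ C ⊕ D → A ⊕ (B ⊕ C) ≡ D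
⊕-transpose {A = A} {B} {C} {D} A⊕B≡C⊕D = begin
  A ⊕ (B ⊕ C)  ≡⟨ ⊕-assoc A B C ⟨
  (A ⊕ B) ⊕ C  ≡⟨ cong (_⊕ C) A⊕B≡C⊕D ⟩
  (C ⊕ D) ⊕ C  ≡⟨ cong (_⊕ C) (⊕-comm C D) ⟩
  (D ⊕ C) ⊕ C  ≡⟨ ⊕-assoc D C C ⟩
  D ⊕ (C ⊕ C)  ≡⟨ cong (D ⊕_) (⊕-self C) ⟩
  D ⊕ ∅        ≡⟨ ⊕-identityʳ D ⟩
  D            ∎
  where open ≡-Reasoning

subset-ext : ∀ {n} {A B : Subset n} → (∀ i → lookup A i ≡ lookup B i) → A ≡ B
subset-ext {A = A} {B} eq =
  trans (sym (tabulate∘lookup A)) (trans (tabulate-cong eq) (tabulate∘lookup B))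

module Sums {c ℓ} (M : CommutativeMonoid c ℓ) where

  open CommutativeMonoid M
    renaming (_≈_ to _≃_; refl to ≃-refl; sym to ≃-sym; trans to ≃-trans; reflexive to ≃-reflexive)
  open CommutativeSemigroupProperties commutativeSemigroup using (interchange)

  sum : ∀ {a} {A : Set a} → List A → (A → Carrier) → Carrier
  sum xs f = foldr (λ x acc → f x ∙ acc) ε xs

  module _ {a} {A : Set a} where

    sum-cong : ∀ (xs : List A) {f g : A → Carrier} → (∀ x → f x ≃ g x) → sum xs f ≃ sum xs g
    sum-cong []       f≈g = ≃-refl
    sum-cong (x ∷ xs) f≈g = ∙-cong (f≈g x) (sum-cong xs f≈g)

    sum-++ : ∀ (xs ys : List A) f → sum (xs ++ ys) f ≃ sum xs f ∙ sum ys f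
    sum-++ []       ys f = ≃-sym (identityˡ _)
    sum-++ (x ∷ xs) ys f = ≃-trans (∙-congˡ (sum-++ xs ys f)) (≃-sym (assoc _ _ _))

    sum-∙ : ∀ (xs : List A) f g → sum xs (λ x → f x ∙ g x) ≃ sum xs f ∙ sum xs g
    sum-∙ []       f g = ≃-sym (identityˡ ε)
    sum-∙ (x ∷ xs) f g = ≃-trans (∙-congˡ (sum-∙ xs f g)) (interchange _ _ _ _)

    sum-ε : ∀ (xs : List A) {f} → (∀ x → f x ≃ ε) → sum xs f ≃ ε
    sum-ε []       f≈ε = ≃-refl
    sum-ε (x ∷ xs) f≈ε = ≃-trans (∙-cong (f≈ε x) (sum-ε xs f≈ε)) (identityˡ ε)

    sum-map : ∀ {b} {B : Set b} (xs : List B) (h : B → A) f → sum (map h xs) f ≡ sum xs (f ∘ h)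
    sum-map []       h f = ≡.refl
    sum-map (x ∷ xs) h f = ≡.cong (f (h x) ∙_) (sum-map xs h f)

  sumSubsets : ∀ {n} → (Subset n → Carrier) → Carrier
  sumSubsets {n} = sum (allSubsets n)

  sumSubsets-suc : ∀ {n} (f : Subset (suc n) → Carrier) →
    sumSubsets f ≃ sumSubsets (f ∘ (outside ∷_)) ∙ sumSubsets (f ∘ (inside ∷_))
  sumSubsets-suc {n} f = ≃-trans (sum-++ (map (outside ∷_) (allSubsets n)) _ f)
    (≃-reflexive (≡.cong₂ _∙_ (sum-map (allSubsets n) _ f) (sum-map (allSubsets n) _ f)))

  sumSubsets-vanishing : ∀ {n} {f : Subset n → Carrier} → (∀ X → f X ≃ ε) → sumSubsets f ≃ ε
  sumSubsets-vanishing {n} = sum-ε (allSubsets n)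

  sumSubsets-single : ∀ {n} (B : Subset n) {f : Subset n → Carrier} →
    (∀ X → X ≢ B → f X ≃ ε) → sumSubsets f ≃ f B
  sumSubsets-single [] f≈ε = identityʳ _
  sumSubsets-single (outside ∷ B) {f} f≈ε = ≃-trans (sumSubsets-suc f) (≃-trans
    (∙-cong (sumSubsets-single B (λ X X≢B → f≈ε (outside ∷ X) (X≢B ∘ ≡.cong Vec.tail)))
            (sumSubsets-vanishing (λ X → f≈ε (inside ∷ X) λ ())))
    (identityʳ _))
  sumSubsets-single (inside ∷ B) {f} f≈ε = ≃-trans (sumSubsets-suc f) (≃-trans
    (∙-cong (sumSubsets-vanishing (λ X → f≈ε (outside ∷ X) λ ()))
            (sumSubsets-single B (λ X X≢B → f≈ε (inside ∷ X) (X≢B ∘ ≡.cong Vec.tail))))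
    (identityˡ _))

  sumSubsets-⊕-invariant : ∀ {n} (A : Subset n) (f : Subset n → Carrier) →
    sumSubsets (λ X → f (A ⊕ X)) ≃ sumSubsets f
  sumSubsets-⊕-invariant [] f = ≃-refl
  sumSubsets-⊕-invariant (outside ∷ A) f = ≃-trans (sumSubsets-suc (λ X → f ((outside ∷ A) ⊕ X))) (≃-trans
    (∙-cong (sumSubsets-⊕-invariant A (f ∘ (outside ∷_))) (sumSubsets-⊕-invariant A (f ∘ (inside ∷_))))
    (≃-sym (sumSubsets-suc f)))
  sumSubsets-⊕-invariant (inside ∷ A) f = ≃-trans (sumSubsets-suc (λ X → f ((inside ∷ A) ⊕ X))) (≃-trans
    (∙-cong (sumSubsets-⊕-invariant A (f ∘ (inside ∷_))) (sumSubsets-⊕-invariant A (f ∘ (outside ∷_))))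
    (≃-trans (comm _ _) (≃-sym (sumSubsets-suc f))))

module Sumℤ = Sums ℤₚ.+-0-commutativeMonoid
module Sumℕ = Sums ℕₚ.+-0-commutativeMonoid

sum-*ˡ : ∀ {a} {A : Set a} (xs : List A) (c : ℤ) (f : A → ℤ) →
  Sumℤ.sum xs (λ x → c ℤ.* f x) ≡ c ℤ.* Sumℤ.sum xs f
sum-*ˡ []       c f = sym (ℤₚ.*-zeroʳ c)
sum-*ˡ (x ∷ xs) c f = trans (cong (λ z → c ℤ.* f x ℤ.+ z) (sum-*ˡ xs c f)) (sym (ℤₚ.*-distribˡ-+ c (f x) _))

sum-neg : ∀ {a} {A : Set a} (xs : List A) (f : A → ℤ) → Sumℤ.sum xs (λ x → ℤ.- f x) ≡ ℤ.- Sumℤ.sum xs f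
sum-neg []       f = refl
sum-neg (x ∷ xs) f = trans (cong (λ z → ℤ.- f x ℤ.+ z) (sum-neg xs f)) (sym (ℤₚ.neg-distrib-+ (f x) _))

sum-mono-≤ : ∀ {a} {A : Set a} (xs : List A) {f g : A → ℕ} → (∀ x → f x ≤ g x) → Sumℕ.sum xs f ≤ Sumℕ.sum xs g
sum-mono-≤ []       f≤g = ℕ.z≤n
sum-mono-≤ (x ∷ xs) f≤g = ℕₚ.+-mono-≤ (f≤g x) (sum-mono-≤ xs f≤g)

sum-mono-≤-≡⇒≡ : ∀ {a} {A : Set a} (xs : List A) {f g : A → ℕ} → (∀ x → f x ≤ g x) →
  Sumℕ.sum xs f ≡ Sumℕ.sum xs g → ∀ {x} → x ∈ₗ xs → f x ≡ g x
sum-mono-≤-≡⇒≡ (y ∷ xs) {f} {g} f≤g Σf≡Σg = λ where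
    (here refl) → fy≡gy
    (there x∈xs) → sum-mono-≤-≡⇒≡ xs f≤g Σf≡Σg′ x∈xs
  where
  fy≡gy : f y ≡ g y
  fy≡gy = ℕₚ.≤-antisym (f≤g y) (ℕₚ.+-cancelʳ-≤ (Sumℕ.sum xs f) (g y) (f y)
    (ℕₚ.≤-trans (ℕₚ.+-monoʳ-≤ (g y) (sum-mono-≤ xs f≤g)) (ℕₚ.≤-reflexive (sym Σf≡Σg))))
  Σf≡Σg′ : Sumℕ.sum xs f ≡ Sumℕ.sum xs g
  Σf≡Σg′ = ℕₚ.+-cancelˡ-≡ (f y) _ _ (trans Σf≡Σg (cong (ℕ._+ Sumℕ.sum xs g) (sym fy≡gy)))

+-sum : ∀ {a} {A : Set a} (xs : List A) (f : A → ℕ) → + Sumℕ.sum xs f ≡ Sumℤ.sum xs (+_ ∘ f)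
+-sum []       f = refl
+-sum (x ∷ xs) f = trans (ℤₚ.pos-+ (f x) _) (cong (λ z → + f x ℤ.+ z) (+-sum xs f))

∈-allSubsets : ∀ n (X : Subset n) → X ∈ₗ allSubsets n
∈-allSubsets zero    []            = here refl
∈-allSubsets (suc n) (outside ∷ X) = ∈-++⁺ˡ (∈-map⁺ (outside ∷_) (∈-allSubsets n X))
∈-allSubsets (suc n) (inside ∷ X)  = ∈-++⁺ʳ _ (∈-map⁺ (inside ∷_) (∈-allSubsets n X))

δ-self : ∀ {n} (B : Subset n) → δ B B ≡ + 1
δ-self B with B ≟ₛ B
... | yes _   = refl
... | no B≢B = contradiction refl B≢B

δ-≢ : ∀ {n} {B X : Subset n} → X ≢ B → δ B X ≡ + 0
δ-≢ {B = B} {X} X≢B with X ≟ₛ B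
... | yes X≡B = contradiction X≡B X≢B
... | no _    = refl

δ-⊕ : ∀ {n} (A B X : Subset n) → δ B (A ⊕ X) ≡ δ (A ⊕ B) X
δ-⊕ A B X with (A ⊕ X) ≟ₛ B | X ≟ₛ (A ⊕ B)
... | yes _   | yes _   = refl
... | no _    | no _    = refl
... | yes A⊕X≡B | no X≢A⊕B = contradiction (trans (sym (⊕-cancelˡ A X)) (cong (A ⊕_) A⊕X≡B)) X≢A⊕B
... | no A⊕X≢B | yes X≡A⊕B = contradiction (trans (cong (A ⊕_) X≡A⊕B) (⊕-cancelˡ A B)) A⊕X≢B

sumSubsets-δ* : ∀ {n} (B : Subset n) (h : Subset n → ℤ) → Σℤ (λ X → δ B X ℤ.* h X) ≡ h B
sumSubsets-δ* B h =
  trans (Sumℤ.sumSubsets-single B (λ X X≢B → trans (cong (ℤ._* h X) (δ-≢ X≢B)) (ℤₚ.*-zeroˡ (h X))))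
                          (trans (cong (ℤ._* h B) (δ-self B)) (ℤₚ.*-identityˡ (h B)))

Formal : ℕ → Set
Formal n = List (ℤ × Subset n)

weigh : ∀ {n} → (Subset n → ℤ) → ℤ × Subset n → ℤ
weigh h (c , B) = c ℤ.* h B

⟨_∣_⟩ : ∀ {n} → Formal n → (Subset n → ℤ) → ℤ
⟨ L ∣ h ⟩ = Sumℤ.sum L (weigh h)

⟦_⟧ : ∀ {n} → Formal n → GR n
⟦ L ⟧ X = ⟨ L ∣ (λ B → δ B X) ⟩

⟨⟩-++ : ∀ {n} (K L : Formal n) h → ⟨ K ++ L ∣ h ⟩ ≡ ⟨ K ∣ h ⟩ ℤ.+ ⟨ L ∣ h ⟩
⟨⟩-++ K L h = Sumℤ.sum-++ K L (weigh h)

sumSubsets-⟦⟧* : ∀ {n} (L : Formal n) (h : Subset n → ℤ) →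
  Σℤ (λ X → ⟦ L ⟧ X ℤ.* h X) ≡ ⟨ L ∣ h ⟩
sumSubsets-⟦⟧* [] h = Sumℤ.sumSubsets-vanishing (λ X → ℤₚ.*-zeroˡ (h X))
sumSubsets-⟦⟧* {n} ((c , B) ∷ L) h = begin
  Σℤ (λ X → (c ℤ.* δ B X ℤ.+ ⟦ L ⟧ X) ℤ.* h X)
    ≡⟨ Sumℤ.sum-cong (allSubsets n) (λ X → distrib c (δ B X) (⟦ L ⟧ X) (h X)) ⟩
  Σℤ (λ X → c ℤ.* (δ B X ℤ.* h X) ℤ.+ ⟦ L ⟧ X ℤ.* h X)
    ≡⟨ Sumℤ.sum-∙ (allSubsets n) (λ X → c ℤ.* (δ B X ℤ.* h X)) (λ X → ⟦ L ⟧ X ℤ.* h X) ⟩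
  Σℤ (λ X → c ℤ.* (δ B X ℤ.* h X)) ℤ.+ Σℤ (λ X → ⟦ L ⟧ X ℤ.* h X)
    ≡⟨ cong₂ ℤ._+_ (trans (sum-*ˡ (allSubsets n) c (λ X → δ B X ℤ.* h X)) (cong (c ℤ.*_) (sumSubsets-δ* B h)))
                   (sumSubsets-⟦⟧* L h) ⟩
  c ℤ.* h B ℤ.+ ⟨ L ∣ h ⟩ ∎
  where
  open ≡-Reasoning
  distrib : ∀ a b c d → (a ℤ.* b ℤ.+ c) ℤ.* d ≡ a ℤ.* (b ℤ.* d) ℤ.+ c ℤ.* d
  distrib = solve-∀

negTerm : ∀ {n} → ℤ × Subset n → ℤ × Subset n
negTerm (c , B) = ℤ.- c , B

⟦⟧-neg : ∀ {n} (L : Formal n) X → ⟦ map negTerm L ⟧ X ≡ ℤ.- ⟦ L ⟧ X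
⟦⟧-neg L X = trans (Sumℤ.sum-map L negTerm (weigh (λ B → δ B X)))
  (trans (Sumℤ.sum-cong L (λ q → sym (ℤₚ.neg-distribˡ-* (proj₁ q) _))) (sum-neg L (weigh (λ B → δ B X))))

shiftTerm : ∀ {n} → Subset n → ℤ × Subset n → ℤ × Subset n
shiftTerm W (c , B) = c , W ⊕ B

⟦⟧-shift : ∀ {n} (W : Subset n) (L : Formal n) → shift W ⟦ L ⟧ ≈ ⟦ map (shiftTerm W) L ⟧
⟦⟧-shift W L X = trans (Sumℤ.sum-cong L (λ q → cong (proj₁ q ℤ.*_) (δ-⊕ W (proj₂ q) X)))
                       (sym (Sumℤ.sum-map L (shiftTerm W) (weigh (λ B → δ B X))))

_·ₜ_ : ∀ {n} → ℤ × Subset n → ℤ × Subset n → ℤ × Subset n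
(c , B) ·ₜ (d , C) = c ℤ.* d , B ⊕ C

_⊗_ : ∀ {n} → Formal n → Formal n → Formal n
[]      ⊗ L = []
(q ∷ K) ⊗ L = map (q ·ₜ_) L ++ (K ⊗ L)

⟦⟧-·ₜ : ∀ {n} (c : ℤ) (B : Subset n) L X → ⟦ map ((c , B) ·ₜ_) L ⟧ X ≡ c ℤ.* ⟦ L ⟧ (B ⊕ X)
⟦⟧-·ₜ c B L X = trans (Sumℤ.sum-map L ((c , B) ·ₜ_) (weigh (λ B → δ B X)))
  (trans (Sumℤ.sum-cong L (λ q → trans (cong (c ℤ.* proj₁ q ℤ.*_) (sym (δ-⊕ B (proj₂ q) X)))
                                      (ℤₚ.*-assoc c (proj₁ q) _)))
         (sum-*ˡ L c (weigh (λ C → δ C (B ⊕ X)))))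

⟦⟧-⊗ : ∀ {n} (K L : Formal n) → ⟦ K ⊗ L ⟧ ≈ (⟦ K ⟧ *ᴳ ⟦ L ⟧)
⟦⟧-⊗ K L X = trans (expand K) (sym (sumSubsets-⟦⟧* K (λ Y → ⟦ L ⟧ (Y ⊕ X))))
  where
  expand : ∀ K → ⟦ K ⊗ L ⟧ X ≡ ⟨ K ∣ (λ B → ⟦ L ⟧ (B ⊕ X)) ⟩
  expand []            = refl
  expand ((c , B) ∷ K) = trans (⟨⟩-++ (map ((c , B) ·ₜ_) L) (K ⊗ L) _)
                               (cong₂ ℤ._+_ (⟦⟧-·ₜ c B L X) (expand K))

*ᴳ-cong : ∀ {n} {f f′ g g′ : GR n} → f ≈ f′ → g ≈ g′ → (f *ᴳ g) ≈ (f′ *ᴳ g′)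
*ᴳ-cong {n} f≈f′ g≈g′ X = Sumℤ.sum-cong (allSubsets n) (λ Y → cong₂ ℤ._*_ (f≈f′ Y) (g≈g′ (Y ⊕ X)))

factor : ∀ {n} → Subset n → Formal n
factor Y = (+ 1 , ∅) ∷ (-[1+ 0 ] , Y) ∷ []

⟦factor⟧ : ∀ {n} (Y : Subset n) → (𝟙 -ᴳ δ Y) ≈ ⟦ factor Y ⟧
⟦factor⟧ Y X = lemma (δ ∅ X) (δ Y X)
  where
  lemma : ∀ a b → a ℤ.- b ≡ + 1 ℤ.* a ℤ.+ (-[1+ 0 ] ℤ.* b ℤ.+ + 0)
  lemma = solve-∀

formalForm : ∀ {n} (Y₁ Y₂ Y₃ Z₁ Z₂ Z₃ : Subset n) → Formal n
formalForm Y₁ Y₂ Y₃ Z₁ Z₂ Z₃ =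
  ((factor Y₁ ⊗ factor Y₂) ⊗ factor Y₃) ++ map negTerm ((factor Z₁ ⊗ factor Z₂) ⊗ factor Z₃)

form≈⟦formalForm⟧ : ∀ {n} (Y₁ Y₂ Y₃ Z₁ Z₂ Z₃ : Subset n) →
  form Y₁ Y₂ Y₃ Z₁ Z₂ Z₃ ≈ ⟦ formalForm Y₁ Y₂ Y₃ Z₁ Z₂ Z₃ ⟧
form≈⟦formalForm⟧ {n} Y₁ Y₂ Y₃ Z₁ Z₂ Z₃ X = begin
  form Y₁ Y₂ Y₃ Z₁ Z₂ Z₃ X               ≡⟨ cong₂ ℤ._-_ (cube Y₁ Y₂ Y₃ X) (cube Z₁ Z₂ Z₃ X) ⟩
  ⟦ Ys ⟧ X ℤ.- ⟦ Zs ⟧ X                  ≡⟨ cong (λ z → ⟦ Ys ⟧ X ℤ.+ z) (⟦⟧-neg Zs X) ⟨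
  ⟦ Ys ⟧ X ℤ.+ ⟦ map negTerm Zs ⟧ X      ≡⟨ ⟨⟩-++ Ys (map negTerm Zs) (λ B → δ B X) ⟨
  ⟦ formalForm Y₁ Y₂ Y₃ Z₁ Z₂ Z₃ ⟧ X     ∎
  where
  open ≡-Reasoning
  Ys Zs : Formal n
  Ys = (factor Y₁ ⊗ factor Y₂) ⊗ factor Y₃
  Zs = (factor Z₁ ⊗ factor Z₂) ⊗ factor Z₃
  cube : ∀ A B C → ((𝟙 -ᴳ δ A) *ᴳ (𝟙 -ᴳ δ B) *ᴳ (𝟙 -ᴳ δ C)) ≈ ⟦ (factor A ⊗ factor B) ⊗ factor C ⟧
  cube A B C Y = sym (trans (⟦⟧-⊗ (factor A ⊗ factor B) (factor C) Y)
    (*ᴳ-cong (λ Z → trans (⟦⟧-⊗ (factor A) (factor B) Z)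
                          (*ᴳ-cong (λ V → sym (⟦factor⟧ A V)) (λ V → sym (⟦factor⟧ B V)) Z))
             (λ Z → sym (⟦factor⟧ C Z)) Y))

⟦⟧-∉ : ∀ {n} (L : Formal n) {X} → X ∉ₗ map proj₂ L → ⟦ L ⟧ X ≡ + 0
⟦⟧-∉ []            X∉ = refl
⟦⟧-∉ ((c , B) ∷ L) X∉ = cong₂ ℤ._+_ (trans (cong (c ℤ.*_) (δ-≢ (X∉ ∘ here))) (ℤₚ.*-zeroʳ c))
                                    (⟦⟧-∉ L (X∉ ∘ there))

⟦⟧-∈ : ∀ {n} (L : Formal n) {c X} → Unique (map proj₂ L) → (c , X) ∈ₗ L → ⟦ L ⟧ X ≡ c
⟦⟧-∈ ((c , X) ∷ L) (X∉L ∷ _) (here refl) =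
  trans (cong₂ ℤ._+_ (trans (cong (c ℤ.*_) (δ-self X)) (ℤₚ.*-identityʳ c)) (⟦⟧-∉ L (All¬⇒¬Any X∉L)))
        (ℤₚ.+-identityʳ c)
⟦⟧-∈ ((d , B) ∷ L) (B∉L ∷ u) (there cX∈L) =
  trans (cong₂ ℤ._+_ (trans (cong (d ℤ.*_) (δ-≢ (≢-sym (All.lookup B∉L (∈-map⁺ proj₂ cX∈L))))) (ℤₚ.*-zeroʳ d))
                     (⟦⟧-∈ L u cX∈L))
        (ℤₚ.+-identityˡ _)

_∈ₗ?_ : ∀ {n} (X : Subset n) (Xs : List (Subset n)) → Dec (X ∈ₗ Xs)
_∈ₗ?_ = DecMembership._∈?_ _≟ₛ_

equalᵇ : ∀ {n} → Formal n → Formal n → Bool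
equalᵇ K L = all (λ X → isYes (⟦ K ⟧ X ℤ.≟ ⟦ L ⟧ X)) (map proj₂ (K ++ L))

equalᵇ-sound : ∀ {n} (K L : Formal n) → T (equalᵇ K L) → ∀ X → ⟦ K ⟧ X ≡ ⟦ L ⟧ X
equalᵇ-sound K L holds X with X ∈ₗ? map proj₂ (K ++ L)
... | yes X∈ = toWitness (All.lookup (all⁺ _ _ holds) X∈)
... | no X∉  = trans (⟦⟧-∉ K (X∉ ∘ inK)) (sym (⟦⟧-∉ L (X∉ ∘ inL)))
  where
  inK : X ∈ₗ map proj₂ K → X ∈ₗ map proj₂ (K ++ L)
  inK = subst (X ∈ₗ_) (sym (map-++ proj₂ K L)) ∘ ∈-++⁺ˡ
  inL : X ∈ₗ map proj₂ L → X ∈ₗ map proj₂ (K ++ L)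
  inL = subst (X ∈ₗ_) (sym (map-++ proj₂ K L)) ∘ ∈-++⁺ʳ (map proj₂ K)

_on_ : ∀ {n} → GR n → List (Subset n) → Formal n
F on Bs = map (λ B → F B , B) Bs

support-on : ∀ {n} (F : GR n) Bs → map proj₂ (F on Bs) ≡ Bs
support-on F Bs = trans (sym (map-∘ Bs)) (map-id Bs)

expansion : ∀ {n} (F : GR n) (Bs : List (Subset n)) → Unique Bs →
  (∀ X → X ∉ₗ Bs → F X ≡ + 0) → F ≈ ⟦ F on Bs ⟧
expansion F Bs u F-vanishes X with X ∈ₗ? Bs
... | yes X∈Bs = sym (⟦⟧-∈ (F on Bs) (subst Unique (sym (support-on F Bs)) u) (∈-map⁺ (λ B → F B , B) X∈Bs))
... | no X∉Bs  = trans (F-vanishes X X∉Bs) (sym (⟦⟧-∉ (F on Bs) (X∉Bs ∘ subst (X ∈ₗ_) (support-on F Bs))))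

pos-neg : ∀ t → + pos t ℤ.- + neg t ≡ t
pos-neg (+ k)    = ℤₚ.+-identityʳ (+ k)
pos-neg -[1+ k ] = refl

𝟙ᵇ : Bool → ℤ
𝟙ᵇ b = if b then + 1 else + 0

𝟙[_⊆_] : ∀ {n} → Subset n → Subset n → ℤ
𝟙[ I ⊆ X ] = 𝟙ᵇ (does (I ⊆? X))

module _ {n : ℕ} (T : GR n) (I : Subset n) where

  Restricted : (ℤ → ℕ) → Subset n → ℕ
  Restricted part X = if does (I ⊆? X) then part (T X) else 0

  -- The summands of count₊ and count₋ are anonymous with-functions of Defs; unification
  -- supplies them in the types below.
  mutual
    count₊≡ : count₊ T I ≡ Σℕ (Restricted pos)
    count₊≡ = Sumℕ.sum-cong (allSubsets n) count₊-summand

    count₊-summand : ∀ X → _ ≡ Restricted pos X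
    count₊-summand X with I ⊆? X
    ... | yes _ = refl
    ... | no _  = refl

  mutual
    count₋≡ : count₋ T I ≡ Σℕ (Restricted neg)
    count₋≡ = Sumℕ.sum-cong (allSubsets n) count₋-summand

    count₋-summand : ∀ X → _ ≡ Restricted neg X
    count₋-summand X with I ⊆? X
    ... | yes _ = refl
    ... | no _  = refl

  pos-neg-restricted : ∀ X → + Restricted pos X ℤ.- + Restricted neg X ≡ T X ℤ.* 𝟙[ I ⊆ X ]
  pos-neg-restricted X with I ⊆? X
  ... | yes _ = trans (pos-neg (T X)) (sym (ℤₚ.*-identityʳ (T X)))
  ... | no _  = sym (ℤₚ.*-zeroʳ (T X))

  weighted-count : count₊ T I ≡ count₋ T I → Σℤ (λ X → T X ℤ.* 𝟙[ I ⊆ X ]) ≡ + 0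
  weighted-count balanced = begin
    Σℤ (λ X → T X ℤ.* 𝟙[ I ⊆ X ])
      ≡⟨ Sumℤ.sum-cong (allSubsets n) (λ X → sym (pos-neg-restricted X)) ⟩
    Σℤ (λ X → + Restricted pos X ℤ.- + Restricted neg X)
      ≡⟨ Sumℤ.sum-∙ (allSubsets n) (λ X → + Restricted pos X) (λ X → ℤ.- + Restricted neg X) ⟩
    Σℤ (λ X → + Restricted pos X) ℤ.+ Σℤ (λ X → ℤ.- + Restricted neg X)
      ≡⟨ cong (λ z → Σℤ (λ X → + Restricted pos X) ℤ.+ z) (sum-neg (allSubsets n) (λ X → + Restricted neg X)) ⟩
    Σℤ (λ X → + Restricted pos X) ℤ.- Σℤ (λ X → + Restricted neg X)
      ≡⟨ cong₂ ℤ._-_ (+-sum (allSubsets n) (Restricted pos)) (+-sum (allSubsets n) (Restricted neg)) ⟨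
    + Σℕ (Restricted pos) ℤ.- + Σℕ (Restricted neg)
      ≡⟨ cong₂ (λ a b → + a ℤ.- + b) (trans (sym count₊≡) balanced) (sym count₋≡) ⟩
    + count₋ T I ℤ.- + count₋ T I
      ≡⟨ ℤₚ.+-inverseʳ (+ count₋ T I) ⟩
    + 0 ∎
    where open ≡-Reasoning

balanced-volume : ∀ {n t} {T : GR n} → IsTrade t T → Σℕ (pos ∘ T) ≡ Σℕ (neg ∘ T)
balanced-volume {n} {T = T} trade = begin
  Σℕ (pos ∘ T)                ≡⟨ Sumℕ.sum-cong (allSubsets n) (unrestricted pos) ⟩
  Σℕ (Restricted T ∅ pos)     ≡⟨ count₊≡ T ∅ ⟨
  count₊ T ∅                  ≡⟨ trade ∅ (ℕₚ.≤-trans (ℕₚ.≤-reflexive (∣⊥∣≡0 n)) ℕ.z≤n) ⟩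
  count₋ T ∅                  ≡⟨ count₋≡ T ∅ ⟩
  Σℕ (Restricted T ∅ neg)     ≡⟨ Sumℕ.sum-cong (allSubsets n) (unrestricted neg) ⟨
  Σℕ (neg ∘ T)                ∎
  where
  open ≡-Reasoning
  unrestricted : ∀ (part : ℤ → ℕ) X → part (T X) ≡ (if does (∅ ⊆? X) then part (T X) else 0)
  unrestricted part X with ∅ ⊆? X
  ... | yes _   = refl
  ... | no ∅⊈X = contradiction (λ {x} → ⊆-min X {x}) ∅⊈X

pos-⊖ : ∀ m k → pos (m ⊖ k) ≤ m
pos-⊖ m k with k ℕₚ.≤? m
... | yes k≤m rewrite ℤₚ.⊖-≥ k≤m = ℕₚ.m∸n≤m m k
... | no k≰m rewrite ℤₚ.⊖-< (ℕₚ.≰⇒> k≰m) with k ℕ.∸ m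
...   | zero  = ℕ.z≤n
...   | suc _ = ℕ.z≤n

neg-⊖ : ∀ m k → neg (m ⊖ k) ≤ k
neg-⊖ m k with k ℕₚ.≤? m
... | yes k≤m rewrite ℤₚ.⊖-≥ k≤m = ℕ.z≤n
... | no k≰m rewrite ℤₚ.⊖-< (ℕₚ.≰⇒> k≰m) with k ℕ.∸ m in eq
...   | zero  = ℕ.z≤n
...   | suc j = ℕₚ.≤-trans (ℕₚ.≤-reflexive (sym eq)) (ℕₚ.m∸n≤m k m)

pos-+-≤ : ∀ a b → pos (a ℤ.+ b) ≤ pos a ℕ.+ pos b
pos-+-≤ (+ m)    (+ n)    = ℕₚ.≤-refl
pos-+-≤ (+ m)    -[1+ n ] = ℕₚ.≤-trans (pos-⊖ m (suc n)) (ℕₚ.m≤m+n m 0)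
pos-+-≤ -[1+ m ] (+ n)    = pos-⊖ n (suc m)
pos-+-≤ -[1+ m ] -[1+ n ] = ℕ.z≤n

neg-+-≤ : ∀ a b → neg (a ℤ.+ b) ≤ neg a ℕ.+ neg b
neg-+-≤ (+ m)    (+ n)    = ℕ.z≤n
neg-+-≤ (+ m)    -[1+ n ] = neg-⊖ m (suc n)
neg-+-≤ -[1+ m ] (+ n)    = ℕₚ.≤-trans (neg-⊖ n (suc m)) (ℕₚ.m≤m+n (suc m) 0)
neg-+-≤ -[1+ m ] -[1+ n ] = ℕₚ.≤-reflexive (cong suc (sym (ℕₚ.+-suc m n)))

NoCancellation : ℤ → ℤ → Set
NoCancellation a b = (pos (a ℤ.+ b) ≡ pos a ℕ.+ pos b) × (neg (a ℤ.+ b) ≡ neg a ℕ.+ neg b)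

noCancellation-0ˡ : ∀ b → NoCancellation (+ 0) b
noCancellation-0ˡ b = cong pos (ℤₚ.+-identityˡ b) , cong neg (ℤₚ.+-identityˡ b)

noCancellation-0ʳ : ∀ a → NoCancellation a (+ 0)
noCancellation-0ʳ a = trans (cong pos (ℤₚ.+-identityʳ a)) (sym (ℕₚ.+-identityʳ (pos a))) ,
                      trans (cong neg (ℤₚ.+-identityʳ a)) (sym (ℕₚ.+-identityʳ (neg a)))

pos-neg-exclusive : ∀ c {x y} → ¬ (pos c ≡ suc x × neg c ≡ suc y)
pos-neg-exclusive (+ _)    (_ , ())
pos-neg-exclusive -[1+ _ ] (() , _)

noCancellation-unit : ∀ a b {c} → NoCancellation a b → a ℤ.+ b ≡ c → pos c ≤ 1 → neg c ≤ 1 →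
  a ≡ + 0 ⊎ b ≡ + 0
noCancellation-unit (+ 0)     b         _       _    _ _ = inj₁ refl
noCancellation-unit a         (+ 0)     _       _    _ _ = inj₂ refl
noCancellation-unit (+ suc k) (+ suc l) _       refl (ℕ.s≤s k+1+l≤0) _ =
  contradiction (ℕₚ.m+n≤o⇒n≤o k k+1+l≤0) λ ()
noCancellation-unit -[1+ k ]  -[1+ l ]  _       refl _ (ℕ.s≤s ())
noCancellation-unit (+ suc k) -[1+ l ]  (p , n) _    _ _ = contradiction (p , n) (pos-neg-exclusive _)
noCancellation-unit -[1+ k ]  (+ suc l) (p , n) _    _ _ = contradiction (p , n) (pos-neg-exclusive _)

split-at-zero : ∀ {a b c : ℤ} → a ℤ.+ b ≡ c → a ≡ + 0 ⊎ b ≡ + 0 →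
  a ≡ (if isYes (a ℤ.≟ + 0) then + 0 else c) × b ≡ (if isYes (a ℤ.≟ + 0) then c else + 0)
split-at-zero {a} {b} a+b≡c one-zero with a ℤ.≟ + 0 | one-zero
... | yes refl | _         = refl , trans (sym (ℤₚ.+-identityˡ b)) a+b≡c
... | no a≢0   | inj₁ a≡0 = contradiction a≡0 a≢0
... | no _     | inj₂ refl = trans (sym (ℤₚ.+-identityʳ a)) a+b≡c , refl

noCancellation-zero : ∀ {a b} → NoCancellation a b → a ℤ.+ b ≡ + 0 → a ≡ + 0 × b ≡ + 0
noCancellation-zero {a} {b} nc a+b≡0 =
  let a≡ , b≡ = split-at-zero a+b≡0 (noCancellation-unit a b nc a+b≡0 ℕ.z≤n ℕ.z≤n)
  in trans a≡ (if-eta _) , trans b≡ (if-eta _)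

∈⇒lookup : ∀ {n} {i : Fin n} {A : Subset n} → i ∈ A → lookup A i ≡ true
∈⇒lookup = []=⇒lookup

lookup⇒∈ : ∀ {n} {i : Fin n} {A : Subset n} → lookup A i ≡ true → i ∈ A
lookup⇒∈ {i = i} {A} = lookup⇒[]= i A

∉⇒lookup : ∀ {n} {i : Fin n} {A : Subset n} → ¬ i ∈ A → lookup A i ≡ false
∉⇒lookup {i = i} {A} i∉A with lookup A i in eq
... | true  = contradiction (lookup⇒∈ eq) i∉A
... | false = refl

∈-⁅⁆⊕ : ∀ {n} (s : Fin n) {X : Subset n} → ¬ s ∈ X → s ∈ ⁅ s ⁆ ⊕ X
∈-⁅⁆⊕ s {X} s∉X = lookup⇒∈ (trans (lookup-zipWith _xor_ s ⁅ s ⁆ X)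
  (cong₂ _xor_ (∈⇒lookup (x∈⁅x⁆ s)) (∉⇒lookup s∉X)))

⁅⁆-disjoint : ∀ {n} {s : Fin n} {A : Subset n} → ¬ s ∈ A → Disjoint ⁅ s ⁆ A
⁅⁆-disjoint {s = s} {A} s∉A = subset-ext λ i →
  trans (lookup-zipWith _∧_ i ⁅ s ⁆ A) (trans (meet i) (sym (lookup-replicate i false)))
  where
  meet : ∀ i → lookup ⁅ s ⁆ i ∧ lookup A i ≡ false
  meet i with lookup ⁅ s ⁆ i in i∈⁅s⁆
  ... | false = refl
  ... | true with x∈⁅y⁆⇒x≡y s (lookup⇒∈ i∈⁅s⁆)
  ...   | refl = ∉⇒lookup s∉A

pair⊆ : ∀ {n} {s i : Fin n} {X : Subset n} → s ∈ X → i ∈ X → ⁅ s ⁆ ∪ ⁅ i ⁆ ⊆ X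
pair⊆ {s = s} {i} {X} s∈X i∈X x∈ with x∈p∪q⁻ ⁅ s ⁆ ⁅ i ⁆ x∈
... | inj₁ x∈⁅s⁆ = subst (_∈ X) (sym (x∈⁅y⁆⇒x≡y s x∈⁅s⁆)) s∈X
... | inj₂ x∈⁅i⁆ = subst (_∈ X) (sym (x∈⁅y⁆⇒x≡y i x∈⁅i⁆)) i∈X

𝟙[pair⊆] : ∀ {n} (s i : Fin n) X → 𝟙[ ⁅ s ⁆ ∪ ⁅ i ⁆ ⊆ X ] ≡ 𝟙ᵇ (lookup X s ∧ lookup X i)
𝟙[pair⊆] s i X = cong 𝟙ᵇ (decided (lookup X s) (lookup X i) refl refl)
  where
  decided : ∀ a b → lookup X s ≡ a → lookup X i ≡ b → does ((⁅ s ⁆ ∪ ⁅ i ⁆) ⊆? X) ≡ a ∧ b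
  decided true  true  s∈X i∈X = dec-true ((⁅ s ⁆ ∪ ⁅ i ⁆) ⊆? X) (pair⊆ (lookup⇒∈ s∈X) (lookup⇒∈ i∈X))
  decided true  false _   i∉X = dec-false ((⁅ s ⁆ ∪ ⁅ i ⁆) ⊆? X) λ sub →
    contradiction (trans (sym (∈⇒lookup (sub (x∈p∪q⁺ (inj₂ (x∈⁅x⁆ i)))))) i∉X) λ ()
  decided false _     s∉X _   = dec-false ((⁅ s ⁆ ∪ ⁅ i ⁆) ⊆? X) λ sub →
    contradiction (trans (sym (∈⇒lookup (sub (x∈p∪q⁺ (inj₁ (x∈⁅x⁆ s)))))) s∉X) λ ()

∣p∪q∣≤∣p∣+∣q∣ : ∀ {n} (p q : Subset n) → ∣ p ∪ q ∣ ≤ ∣ p ∣ ℕ.+ ∣ q ∣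
∣p∪q∣≤∣p∣+∣q∣ []          []          = ℕ.z≤n
∣p∪q∣≤∣p∣+∣q∣ (false ∷ p) (false ∷ q) = ∣p∪q∣≤∣p∣+∣q∣ p q
∣p∪q∣≤∣p∣+∣q∣ (false ∷ p) (true ∷ q)  =
  ℕₚ.≤-trans (ℕ.s≤s (∣p∪q∣≤∣p∣+∣q∣ p q)) (ℕₚ.≤-reflexive (sym (ℕₚ.+-suc ∣ p ∣ ∣ q ∣)))
∣p∪q∣≤∣p∣+∣q∣ (true ∷ p)  (false ∷ q) = ℕ.s≤s (∣p∪q∣≤∣p∣+∣q∣ p q)
∣p∪q∣≤∣p∣+∣q∣ (true ∷ p)  (true ∷ q)  =
  ℕ.s≤s (ℕₚ.≤-trans (ℕₚ.m≤n⇒m≤1+n (∣p∪q∣≤∣p∣+∣q∣ p q)) (ℕₚ.≤-reflexive (sym (ℕₚ.+-suc ∣ p ∣ ∣ q ∣))))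

∣pair∣≤2 : ∀ {n} (s i : Fin n) → ∣ ⁅ s ⁆ ∪ ⁅ i ⁆ ∣ ≤ 2
∣pair∣≤2 s i = ℕₚ.≤-trans (∣p∪q∣≤∣p∣+∣q∣ ⁅ s ⁆ ⁅ i ⁆) (ℕₚ.≤-reflexive (cong₂ ℕ._+_ (∣⁅x⁆∣≡1 s) (∣⁅x⁆∣≡1 i)))

extension-noCancellation : ∀ {n t} {T T′ P P′ : GR n} {s : Fin n} →
  IsTrade t T → IsTrade t T′ → vol T′ ≡ vol T → Avoids s P → Avoids s P′ →
  T′ ≈ (P +ᴳ shift x[ s ] P′) → T ≈ (P +ᴳ P′) → ∀ X → NoCancellation (P X) (P′ X)
extension-noCancellation {n} {T = T} {T′} {P} {P′} {s} T-trade T′-trade vol≡ s∉P s∉P′ T′≈ T≈ X =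
  pointwise pos pos-+-≤ pos-total , pointwise neg neg-+-≤ neg-total
  where
  open ≡-Reasoning

  separated : ∀ X → NoCancellation (P X) (P′ (x[ s ] ⊕ X))
  separated X with s ∈? X
  ... | yes s∈X = subst (λ a → NoCancellation a _) (sym (s∉P X s∈X)) (noCancellation-0ˡ _)
  ... | no s∉X  = subst (NoCancellation _) (sym (s∉P′ _ (∈-⁅⁆⊕ s s∉X))) (noCancellation-0ʳ _)

  split : (part : ℤ → ℕ) → (∀ X → part (T′ X) ≡ part (P X) ℕ.+ part (P′ (x[ s ] ⊕ X))) →
          Σℕ (part ∘ T′) ≡ Σℕ (λ X → part (P X) ℕ.+ part (P′ X))
  split part additive = begin
    Σℕ (part ∘ T′)                                         ≡⟨ Sumℕ.sum-cong (allSubsets n) additive ⟩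
    Σℕ (λ X → part (P X) ℕ.+ part (P′ (x[ s ] ⊕ X)))    ≡⟨ Sumℕ.sum-∙ (allSubsets n) (part ∘ P) _ ⟩
    Σℕ (part ∘ P) ℕ.+ Σℕ (λ X → part (P′ (x[ s ] ⊕ X)))
      ≡⟨ cong (Σℕ (part ∘ P) ℕ.+_) (Sumℕ.sumSubsets-⊕-invariant x[ s ] (part ∘ P′)) ⟩
    Σℕ (part ∘ P) ℕ.+ Σℕ (part ∘ P′)                     ≡⟨ Sumℕ.sum-∙ (allSubsets n) (part ∘ P) (part ∘ P′) ⟨
    Σℕ (λ X → part (P X) ℕ.+ part (P′ X))                  ∎

  pos-total : Σℕ (λ X → pos (P X ℤ.+ P′ X)) ≡ Σℕ (λ X → pos (P X) ℕ.+ pos (P′ X))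
  pos-total = begin
    Σℕ (λ X → pos (P X ℤ.+ P′ X))  ≡⟨ Sumℕ.sum-cong (allSubsets n) (λ X → cong pos (T≈ X)) ⟨
    vol T                          ≡⟨ vol≡ ⟨
    vol T′                         ≡⟨ split pos (λ X → trans (cong pos (T′≈ X)) (proj₁ (separated X))) ⟩
    Σℕ (λ X → pos (P X) ℕ.+ pos (P′ X)) ∎

  neg-total : Σℕ (λ X → neg (P X ℤ.+ P′ X)) ≡ Σℕ (λ X → neg (P X) ℕ.+ neg (P′ X))
  neg-total = begin
    Σℕ (λ X → neg (P X ℤ.+ P′ X))  ≡⟨ Sumℕ.sum-cong (allSubsets n) (λ X → cong neg (T≈ X)) ⟨
    Σℕ (neg ∘ T)                    ≡⟨ balanced-volume T-trade ⟨
    vol T                          ≡⟨ vol≡ ⟨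
    vol T′                         ≡⟨ balanced-volume T′-trade ⟩
    Σℕ (neg ∘ T′)                   ≡⟨ split neg (λ X → trans (cong neg (T′≈ X)) (proj₂ (separated X))) ⟩
    Σℕ (λ X → neg (P X) ℕ.+ neg (P′ X)) ∎

  pointwise : (part : ℤ → ℕ) → (∀ a b → part (a ℤ.+ b) ≤ part a ℕ.+ part b) →
    Σℕ (λ X → part (P X ℤ.+ P′ X)) ≡ Σℕ (λ X → part (P X) ℕ.+ part (P′ X)) →
    part (P X ℤ.+ P′ X) ≡ part (P X) ℕ.+ part (P′ X)
  pointwise part subadditive totals =
    sum-mono-≤-≡⇒≡ (allSubsets n) (λ X → subadditive (P X) (P′ X)) totals (∈-allSubsets n X)

nonempty-⊕⇒≢ : ∀ {n} {A B : Subset n} → Nonempty (A ⊕ B) → A ≢ B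
nonempty-⊕⇒≢ (i , i∈A⊕A) refl = ∉⊥ (subst (i ∈_) (⊕-self _) i∈A⊕A)

≢⇒nonempty-⊕ : ∀ {n} (A B : Subset n) → A ≢ B → Nonempty (A ⊕ B)
≢⇒nonempty-⊕ []          []          A≢B = contradiction refl A≢B
≢⇒nonempty-⊕ (true ∷ A)  (false ∷ B) _   = zero , here
≢⇒nonempty-⊕ (false ∷ A) (true ∷ B)  _   = zero , here
≢⇒nonempty-⊕ (true ∷ A)  (true ∷ B)  A≢B = Product.map suc there (≢⇒nonempty-⊕ A B (A≢B ∘ cong (true ∷_)))
≢⇒nonempty-⊕ (false ∷ A) (false ∷ B) A≢B = Product.map suc there (≢⇒nonempty-⊕ A B (A≢B ∘ cong (false ∷_)))

open CommutativeSemigroupProperties (CommutativeRing.+-commutativeSemigroup xor-∧-commutativeRing)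
  using () renaming (interchange to xor-interchange)

_·_ : ∀ {k} → Vec Bool k → Vec Bool k → Bool
[]      · []      = false
(a ∷ u) · (b ∷ v) = (a ∧ b) xor (u · v)

·-⊕ˡ : ∀ {k} (g h p : Vec Bool k) → (g ⊕ h) · p ≡ (g · p) xor (h · p)
·-⊕ˡ []      []      []      = refl
·-⊕ˡ (a ∷ g) (b ∷ h) (c ∷ p) = begin
  ((a xor b) ∧ c) xor ((g ⊕ h) · p)          ≡⟨ cong₂ _xor_ (∧-distribʳ-xor c a b) (·-⊕ˡ g h p) ⟩
  ((a ∧ c) xor (b ∧ c)) xor ((g · p) xor (h · p)) ≡⟨ xor-interchange (a ∧ c) (b ∧ c) (g · p) (h · p) ⟩
  ((a ∧ c) xor (g · p)) xor ((b ∧ c) xor (h · p)) ∎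
  where open ≡-Reasoning

·-zeroˡ : ∀ {k} (p : Vec Bool k) → ∅ · p ≡ false
·-zeroˡ []      = refl
·-zeroˡ (_ ∷ p) = ·-zeroˡ p

∀ᵇ : ∀ k → (Vec Bool k → Bool) → Bool
∀ᵇ zero    f = f []
∀ᵇ (suc k) f = ∀ᵇ k (f ∘ (false ∷_)) ∧ ∀ᵇ k (f ∘ (true ∷_))

∀ᵇ-sound : ∀ k (f : Vec Bool k → Bool) → ∀ᵇ k f ≡ true → ∀ v → f v ≡ true
∀ᵇ-sound zero    f holds []          = holds
∀ᵇ-sound (suc k) f holds (false ∷ v) = ∀ᵇ-sound k _ (∧-conicalˡ _ _ holds) v
∀ᵇ-sound (suc k) f holds (true ∷ v)  = ∀ᵇ-sound k _ (∧-conicalʳ _ _ holds) v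

separatedBy : ∀ {k} → List (Vec Bool k × Vec Bool k) → Vec Bool k → Bool
separatedBy pairs p = all (λ ab → not ((proj₁ ab · p) ∧ (proj₂ ab · p))) pairs

module _ {k : ℕ} (types : List (Vec Bool k)) where

  onTypes : (Vec Bool k → Bool) → Bool
  onTypes Q = all Q types

  subsetᵇ : Vec Bool k → Vec Bool k → Bool
  subsetᵇ g h = onTypes (λ p → not (g · p) ∨ (h · p))

  disjointᵇ : Vec Bool k → Vec Bool k → Bool
  disjointᵇ a b = onTypes (λ p → not ((a · p) ∧ (b · p)))

  regionᵇ : Vec Bool k → Vec Bool k → Vec Bool k → Bool
  regionᵇ g R₁ R₂ = onTypes (λ p → not (g · p) ∨ (isYes (p ≟ₛ R₁) ∨ isYes (p ≟ₛ R₂)))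

  nonemptyᵇ : List (Vec Bool k) → Vec Bool k → Bool
  nonemptyᵇ known h = any (λ g → subsetᵇ g h) known

implication : ∀ {a b} → T (not a ∨ b) → T a → T b
implication {true} b _ = b

combination : ∀ {n k} → Vec (Subset n) k → Vec Bool k → Subset n
combination []       []      = ∅
combination (B ∷ Bs) (b ∷ g) = if b then B ⊕ combination Bs g else combination Bs g

-- ⟪ g ⟫ is the ⊕ of the generators selected by g, and type i records which generators contain i.
-- Both are Boolean vectors, and i ∈ ⟪ g ⟫ exactly when g · type i (lookup-⟪⟫), so statements about
-- sets built from the generators reduce to finitely many statements about types.
module Symbolic {n k : ℕ} (gens : Vec (Subset n) k) where

  ⟪_⟫ : Vec Bool k → Subset n
  ⟪_⟫ = combination gens

  type : Fin n → Vec Bool k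
  type i = Vec.map (λ B → lookup B i) gens

  lookup-⟪⟫ : ∀ g i → lookup ⟪ g ⟫ i ≡ g · type i
  lookup-⟪⟫ = go gens
    where
    go : ∀ {k} (Bs : Vec (Subset n) k) g i → lookup (combination Bs g) i ≡ g · Vec.map (λ B → lookup B i) Bs
    go []       []          i = lookup-replicate i false
    go (B ∷ Bs) (true ∷ g)  i = trans (lookup-zipWith _xor_ i B _) (cong (lookup B i xor_) (go Bs g i))
    go (B ∷ Bs) (false ∷ g) i = go Bs g i

  ∈⟪⟫⇒ : ∀ {g i} → i ∈ ⟪ g ⟫ → T (g · type i)
  ∈⟪⟫⇒ {g} {i} i∈ = Equivalence.from T-≡ (trans (sym (lookup-⟪⟫ g i)) (∈⇒lookup i∈))

  ⇒∈⟪⟫ : ∀ {g i} → T (g · type i) → i ∈ ⟪ g ⟫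
  ⇒∈⟪⟫ {g} {i} t = lookup⇒∈ (trans (lookup-⟪⟫ g i) (Equivalence.to T-≡ t))

  ⟪⟫-⊕ : ∀ g h → ⟪ g ⊕ h ⟫ ≡ ⟪ g ⟫ ⊕ ⟪ h ⟫
  ⟪⟫-⊕ g h = subset-ext λ i → begin
    lookup ⟪ g ⊕ h ⟫ i                   ≡⟨ lookup-⟪⟫ (g ⊕ h) i ⟩
    (g ⊕ h) · type i                     ≡⟨ ·-⊕ˡ g h (type i) ⟩
    (g · type i) xor (h · type i)        ≡⟨ cong₂ _xor_ (lookup-⟪⟫ g i) (lookup-⟪⟫ h i) ⟨
    lookup ⟪ g ⟫ i xor lookup ⟪ h ⟫ i    ≡⟨ lookup-zipWith _xor_ i ⟪ g ⟫ ⟪ h ⟫ ⟨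
    lookup (⟪ g ⟫ ⊕ ⟪ h ⟫) i             ∎
    where open ≡-Reasoning

  ⟪∅⟫ : ⟪ ∅ ⟫ ≡ ∅
  ⟪∅⟫ = subset-ext λ i → trans (lookup-⟪⟫ ∅ i) (trans (·-zeroˡ (type i)) (sym (lookup-replicate i false)))

  module Typed (types : List (Vec Bool k)) (typed : ∀ i → type i ∈ₗ types) where

    onTypes-sound : ∀ {Q} → T (onTypes types Q) → ∀ i → T (Q (type i))
    onTypes-sound {Q} holds i = All.lookup (all⁺ Q types holds) (typed i)

    subsetᵇ-sound : ∀ {g h} → T (subsetᵇ types g h) → ⟪ g ⟫ ⊆ ⟪ h ⟫
    subsetᵇ-sound holds {i} i∈g = ⇒∈⟪⟫ (implication (onTypes-sound holds i) (∈⟪⟫⇒ i∈g))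

    disjointᵇ-sound : ∀ {a b} → T (disjointᵇ types a b) → Disjoint ⟪ a ⟫ ⟪ b ⟫
    disjointᵇ-sound {a} {b} holds = subset-ext λ i → begin
      lookup (⟪ a ⟫ ∩ ⟪ b ⟫) i               ≡⟨ lookup-zipWith _∧_ i ⟪ a ⟫ ⟪ b ⟫ ⟩
      lookup ⟪ a ⟫ i ∧ lookup ⟪ b ⟫ i        ≡⟨ cong₂ _∧_ (lookup-⟪⟫ a i) (lookup-⟪⟫ b i) ⟩
      (a · type i) ∧ (b · type i)            ≡⟨ Equivalence.to T-not-≡ (onTypes-sound holds i) ⟩
      false                                  ≡⟨ lookup-replicate i false ⟨
      lookup ∅ i                             ∎
      where open ≡-Reasoning

    regionᵇ-sound : ∀ {g R₁ R₂} → T (regionᵇ types g R₁ R₂) → ∀ {i} → i ∈ ⟪ g ⟫ → type i ≡ R₁ ⊎ type i ≡ R₂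
    regionᵇ-sound {g} {R₁} {R₂} holds {i} i∈g =
      Sum.map (toWitness {a? = type i ≟ₛ R₁}) (toWitness {a? = type i ≟ₛ R₂})
              (Equivalence.to T-∨ (implication (onTypes-sound holds i) (∈⟪⟫⇒ i∈g)))

    nonemptyᵇ-sound : ∀ {known h} → All (Nonempty ∘ ⟪_⟫) known → T (nonemptyᵇ types known h) → Nonempty ⟪ h ⟫
    nonemptyᵇ-sound {g ∷ known} (nonempty-g ∷ nonempty-known) holds with Equivalence.to T-∨ holds
    ... | inj₁ g⊆h = Product.map₂ (subsetᵇ-sound g⊆h) nonempty-g
    ... | inj₂ rest = nonemptyᵇ-sound nonempty-known rest

  realiseTerm : ℤ × Vec Bool k → ℤ × Subset n
  realiseTerm (c , g) = c , ⟪ g ⟫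

  realise : Formal k → Formal n
  realise = map realiseTerm

  realise-map : ∀ {f : ℤ × Vec Bool k → ℤ × Vec Bool k} {f′ : ℤ × Subset n → ℤ × Subset n} →
    (∀ q → realiseTerm (f q) ≡ f′ (realiseTerm q)) → ∀ L → realise (map f L) ≡ map f′ (realise L)
  realise-map commutes L = trans (sym (map-∘ L)) (trans (map-cong commutes L) (map-∘ L))

  realise-⊗ : ∀ K L → realise (K ⊗ L) ≡ realise K ⊗ realise L
  realise-⊗ []            L = refl
  realise-⊗ ((c , g) ∷ K) L = trans (map-++ realiseTerm (map ((c , g) ·ₜ_) L) (K ⊗ L))
    (cong₂ _++_ (realise-map (λ (d , h) → cong (c ℤ.* d ,_) (⟪⟫-⊕ g h)) L) (realise-⊗ K L))

  realise-factor : ∀ g → realise (factor g) ≡ factor ⟪ g ⟫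
  realise-factor g = cong (λ E → (+ 1 , E) ∷ (-[1+ 0 ] , ⟪ g ⟫) ∷ []) ⟪∅⟫

  realise-formalForm : ∀ y₁ y₂ y₃ z₁ z₂ z₃ →
    realise (formalForm y₁ y₂ y₃ z₁ z₂ z₃) ≡ formalForm ⟪ y₁ ⟫ ⟪ y₂ ⟫ ⟪ y₃ ⟫ ⟪ z₁ ⟫ ⟪ z₂ ⟫ ⟪ z₃ ⟫
  realise-formalForm y₁ y₂ y₃ z₁ z₂ z₃ =
    trans (map-++ realiseTerm ((factor y₁ ⊗ factor y₂) ⊗ factor y₃) (map negTerm Zs))
          (cong₂ _++_ (cube y₁ y₂ y₃)
                      (trans (realise-map {f′ = negTerm} (λ _ → refl) Zs) (cong (map negTerm) (cube z₁ z₂ z₃))))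
    where
    Zs : Formal k
    Zs = (factor z₁ ⊗ factor z₂) ⊗ factor z₃
    cube : ∀ a b c → realise ((factor a ⊗ factor b) ⊗ factor c) ≡ (factor ⟪ a ⟫ ⊗ factor ⟪ b ⟫) ⊗ factor ⟪ c ⟫
    cube a b c = trans (realise-⊗ (factor a ⊗ factor b) (factor c))
      (cong₂ _⊗_ (trans (realise-⊗ (factor a) (factor b)) (cong₂ _⊗_ (realise-factor a) (realise-factor b)))
                 (realise-factor c))

  realise-shift : ∀ w L → realise (map (shiftTerm w) L) ≡ map (shiftTerm ⟪ w ⟫) (realise L)
  realise-shift w = realise-map (λ (c , g) → cong (c ,_) (⟪⟫-⊕ w g))

  ⟨realise∣⟩ : ∀ L (h : Subset n → ℤ) → ⟨ realise L ∣ h ⟩ ≡ ⟨ L ∣ h ∘ ⟪_⟫ ⟩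
  ⟨realise∣⟩ L h = Sumℤ.sum-map L realiseTerm (weigh h)

  ⟦realise⟧ : ∀ L X → ⟦ realise L ⟧ X ≡ Σℤ (λ g → ⟦ L ⟧ g ℤ.* δ ⟪ g ⟫ X)
  ⟦realise⟧ L X = trans (⟨realise∣⟩ L (λ B → δ B X)) (sym (sumSubsets-⟦⟧* L (λ g → δ ⟪ g ⟫ X)))

  ⟦realise⟧-cong : ∀ {K L} → (∀ g → ⟦ K ⟧ g ≡ ⟦ L ⟧ g) → ⟦ realise K ⟧ ≈ ⟦ realise L ⟧
  ⟦realise⟧-cong {K} {L} K≈L X = trans (⟦realise⟧ K X)
    (trans (Sumℤ.sum-cong (allSubsets k) (λ g → cong (ℤ._* δ ⟪ g ⟫ X) (K≈L g))) (sym (⟦realise⟧ L X)))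

  separated-types : ∀ pairs types → ∀ᵇ k (λ p → not (separatedBy pairs p) ∨ isYes (p ∈ₗ? types)) ≡ true →
    All (λ ab → Disjoint ⟪ proj₁ ab ⟫ ⟪ proj₂ ab ⟫) pairs → ∀ i → type i ∈ₗ types
  separated-types pairs types covered disjoint i =
    toWitness (implication (Equivalence.from T-≡ (∀ᵇ-sound k _ covered (type i))) (all⁻ _ (All.map separated disjoint)))
    where
    separated : ∀ {ab} → Disjoint ⟪ proj₁ ab ⟫ ⟪ proj₂ ab ⟫ → T (not ((proj₁ ab · type i) ∧ (proj₂ ab · type i)))
    separated {a , b} a∩b≡∅ = Equivalence.from T-not-≡ (begin
      (a · type i) ∧ (b · type i)       ≡⟨ cong₂ _∧_ (lookup-⟪⟫ a i) (lookup-⟪⟫ b i) ⟨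
      lookup ⟪ a ⟫ i ∧ lookup ⟪ b ⟫ i    ≡⟨ lookup-zipWith _∧_ i ⟪ a ⟫ ⟪ b ⟫ ⟨
      lookup (⟪ a ⟫ ∩ ⟪ b ⟫) i           ≡⟨ cong (λ A → lookup A i) a∩b≡∅ ⟩
      lookup ∅ i                         ≡⟨ lookup-replicate i false ⟩
      false                              ∎)
      where open ≡-Reasoning

-- FormConditions is, definitionally, this shape instantiated with Disjoint, Nonempty, _≢_ and
-- λ A B C D → A ⊕ B ≡ C ⊕ D.
Conditions : {A : Set} (Disj : A → A → Set) (NonEmpty : A → Set) (Distinct : A → A → Set)
             (SameSum : A → A → A → A → Set) (y₁ y₂ y₃ z₁ z₂ z₃ : A) → Set
Conditions Disj NonEmpty Distinct SameSum y₁ y₂ y₃ z₁ z₂ z₃ =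
  (Disj y₁ y₂ × Disj y₁ y₃ × Disj y₂ y₃) ×
  (NonEmpty y₁ × NonEmpty y₂ × NonEmpty y₃) ×
  (Disj z₁ z₂ × Disj z₁ z₃ × Disj z₂ z₃) ×
  (NonEmpty z₁ × NonEmpty z₂ × NonEmpty z₃) ×
  (Distinct y₁ y₂ × Distinct y₁ y₃ × Distinct y₁ z₁ × Distinct y₁ z₂ × Distinct y₁ z₃ ×
   Distinct y₂ y₃ × Distinct y₂ z₁ × Distinct y₂ z₂ × Distinct y₂ z₃ ×
   Distinct y₃ z₁ × Distinct y₃ z₂ × Distinct y₃ z₃ ×
   Distinct z₁ z₂ × Distinct z₁ z₃ × Distinct z₂ z₃) ×
  SameSum y₁ y₂ z₁ z₂

module _ {A : Set} {Disj : A → A → Set} {NonEmpty : A → Set} {Distinct : A → A → Set}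
         {SameSum : A → A → A → A → Set} where

  Conditions-map : ∀ {B : Set} {Disj′ : B → B → Set} {NonEmpty′ : B → Set} {Distinct′ : B → B → Set}
    {SameSum′ : B → B → B → B → Set} (f : A → B) →
    (∀ {a b} → Disj a b → Disj′ (f a) (f b)) → (∀ {a} → NonEmpty a → NonEmpty′ (f a)) →
    (∀ {a b} → Distinct a b → Distinct′ (f a) (f b)) →
    (∀ {a b c d} → SameSum a b c d → SameSum′ (f a) (f b) (f c) (f d)) →
    ∀ {y₁ y₂ y₃ z₁ z₂ z₃} → Conditions Disj NonEmpty Distinct SameSum y₁ y₂ y₃ z₁ z₂ z₃ →
    Conditions Disj′ NonEmpty′ Distinct′ SameSum′ (f y₁) (f y₂) (f y₃) (f z₁) (f z₂) (f z₃)
  Conditions-map f d n di s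
    ((d₁ , d₂ , d₃) , (n₁ , n₂ , n₃) , (d₄ , d₅ , d₆) , (n₄ , n₅ , n₆) ,
     (q₁ , q₂ , q₃ , q₄ , q₅ , q₆ , q₇ , q₈ , q₉ , q₁₀ , q₁₁ , q₁₂ , q₁₃ , q₁₄ , q₁₅) , e) =
    (d d₁ , d d₂ , d d₃) , (n n₁ , n n₂ , n n₃) , (d d₄ , d d₅ , d d₆) , (n n₄ , n n₅ , n n₆) ,
    (di q₁ , di q₂ , di q₃ , di q₄ , di q₅ , di q₆ , di q₇ , di q₈ , di q₉ , di q₁₀ , di q₁₁ , di q₁₂ ,
     di q₁₃ , di q₁₄ , di q₁₅) , s e

  Conditions? : (∀ a b → Dec (Disj a b)) → (∀ a → Dec (NonEmpty a)) → (∀ a b → Dec (Distinct a b)) →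
    (∀ a b c d → Dec (SameSum a b c d)) →
    ∀ y₁ y₂ y₃ z₁ z₂ z₃ → Dec (Conditions Disj NonEmpty Distinct SameSum y₁ y₂ y₃ z₁ z₂ z₃)
  Conditions? d? n? di? s? y₁ y₂ y₃ z₁ z₂ z₃ =
    (d? y₁ y₂ ×-dec d? y₁ y₃ ×-dec d? y₂ y₃) ×-dec
    (n? y₁ ×-dec n? y₂ ×-dec n? y₃) ×-dec
    (d? z₁ z₂ ×-dec d? z₁ z₃ ×-dec d? z₂ z₃) ×-dec
    (n? z₁ ×-dec n? z₂ ×-dec n? z₃) ×-dec
    (di? y₁ y₂ ×-dec di? y₁ y₃ ×-dec di? y₁ z₁ ×-dec di? y₁ z₂ ×-dec di? y₁ z₃ ×-dec
     di? y₂ y₃ ×-dec di? y₂ z₁ ×-dec di? y₂ z₂ ×-dec di? y₂ z₃ ×-dec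
     di? y₃ z₁ ×-dec di? y₃ z₂ ×-dec di? y₃ z₃ ×-dec
     di? z₁ z₂ ×-dec di? z₁ z₃ ×-dec di? z₂ z₃) ×-dec
    s? y₁ y₂ z₁ z₂

-- The coordinates stand for the generators Y₁, Y₂, Y₃, Z₁, Z₃ and {s} (see Configuration);
-- Z₂ = Y₁Y₂Z₁ is forced by Y₁Y₂ = Z₁Z₂.
Sym : Set
Sym = Vec Bool 6

y₁ y₂ y₃ z₁ z₃ σ : Sym
y₁ = true  ∷ false ∷ false ∷ false ∷ false ∷ false ∷ []
y₂ = false ∷ true  ∷ false ∷ false ∷ false ∷ false ∷ []
y₃ = false ∷ false ∷ true  ∷ false ∷ false ∷ false ∷ []
z₁ = false ∷ false ∷ false ∷ true  ∷ false ∷ false ∷ []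
z₃ = false ∷ false ∷ false ∷ false ∷ true  ∷ false ∷ []
σ  = false ∷ false ∷ false ∷ false ∷ false ∷ true  ∷ []

z₂ : Sym
z₂ = y₁ ⊕ (y₂ ⊕ z₁)

familyPairs : List (Sym × Sym)
familyPairs = (y₁ , y₂) ∷ (y₁ , y₃) ∷ (y₂ , y₃) ∷ (z₁ , z₂) ∷ (z₁ , z₃) ∷ (z₂ , z₃) ∷ []

avoidancePairs : List (Sym × Sym)
avoidancePairs = (σ , y₁) ∷ (σ , y₂) ∷ (σ , y₃) ∷ (σ , z₁) ∷ (σ , z₃) ∷ []

-- The types of the elements other than s, once the disjointness conditions hold.
basicTypes : List Sym
basicTypes = ∅ ∷ (y₁ ⊕ z₁) ∷ y₁ ∷ (y₂ ⊕ z₁) ∷ y₂ ∷ (y₃ ⊕ z₃) ∷ y₃ ∷ z₃ ∷ []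

familyTypes extendedTypes : List Sym
familyTypes   = basicTypes ++ map (σ ⊕_) basicTypes
extendedTypes = σ ∷ basicTypes

-- T expanded: the terms 1 and Y₁Y₂ = Z₁Z₂ of the two products cancel.
blocks : Vec (ℤ × Sym) 12
blocks =
  (+ 1 , y₁ ⊕ y₃) ∷ (+ 1 , y₂ ⊕ y₃) ∷ (+ 1 , z₁) ∷ (+ 1 , z₂) ∷ (+ 1 , z₃) ∷ (+ 1 , z₁ ⊕ (z₂ ⊕ z₃)) ∷
  (-[1+ 0 ] , y₁) ∷ (-[1+ 0 ] , y₂) ∷ (-[1+ 0 ] , y₃) ∷ (-[1+ 0 ] , y₁ ⊕ (y₂ ⊕ y₃)) ∷
  (-[1+ 0 ] , z₁ ⊕ z₃) ∷ (-[1+ 0 ] , z₂ ⊕ z₃) ∷ []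

blockSets : List Sym
blockSets = map proj₂ (Vec.toList blocks)

-- (g , R₁ , R₂): the nonempty set ⟪ g ⟫ consists of elements of types R₁ and R₂.
regions : List (Sym × Sym × Sym)
regions =
  (y₁ , y₁ ⊕ z₁ , y₁) ∷ (y₂ , y₂ ⊕ z₁ , y₂) ∷ (y₃ , y₃ ⊕ z₃ , y₃) ∷
  (z₁ , y₁ ⊕ z₁ , y₂ ⊕ z₁) ∷ (z₂ , y₁ , y₂) ∷ (z₃ , y₃ ⊕ z₃ , z₃) ∷
  (y₁ ⊕ z₁ , y₁ , y₂ ⊕ z₁) ∷ (y₁ ⊕ z₂ , y₁ ⊕ z₁ , y₂) ∷ (y₃ ⊕ z₃ , y₃ , z₃) ∷ (σ , σ , σ) ∷ []

known : List Sym
known = map proj₁ regions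

-- Bit j of m says whether the j-th block lies in x_s P′ rather than in P.
keepTerm moveTerm : Bool → ℤ × Sym → ℤ × Sym
keepTerm sent (c , g) = (if sent then + 0 else c) , g
moveTerm sent (c , g) = (if sent then c else + 0) , σ ⊕ g

splitFormal : Vec Bool 12 → Formal 6
splitFormal m = Vec.toList (Vec.zipWith keepTerm m blocks) ++ Vec.toList (Vec.zipWith moveTerm m blocks)

-- For p = type i this is the weighted count of the blocks containing both s and i.
pairSum : Formal 6 → Sym → ℤ
pairSum L p = ⟨ L ∣ (λ g → 𝟙ᵇ ((g · σ) ∧ (g · p))) ⟩

vanishesᵇ : Vec Bool 12 → Sym → Bool
vanishesᵇ m p = isYes (pairSum (splitFormal m) p ℤ.≟ + 0)

someVanishesᵇ : Vec Bool 12 → Sym × Sym × Sym → Bool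
someVanishesᵇ m (_ , R₁ , R₂) = vanishesᵇ m R₁ ∨ vanishesᵇ m R₂

admissibleᵇ : Vec Bool 12 → Bool
admissibleᵇ m = all (someVanishesᵇ m) regions

record Solution : Set where
  constructor solution
  field
    moved : List Sym
    w y₁′ y₂′ y₃′ z₁′ z₂′ z₃′ : Sym

movedMask : List Sym → Vec Bool 12
movedMask moved = Vec.map (λ q → isYes (proj₂ q ∈ₗ? moved)) blocks

conditions? : ∀ y₁′ y₂′ y₃′ z₁′ z₂′ z₃′ → Dec (Conditions (λ a b → T (disjointᵇ extendedTypes a b))
  (T ∘ nonemptyᵇ extendedTypes known) (λ a b → T (nonemptyᵇ extendedTypes known (a ⊕ b)))
  (λ a b c d → a ⊕ b ≡ c ⊕ d) y₁′ y₂′ y₃′ z₁′ z₂′ z₃′)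
conditions? = Conditions? (λ a b → T? (disjointᵇ extendedTypes a b)) (T? ∘ nonemptyᵇ extendedTypes known)
  (λ a b → T? (nonemptyᵇ extendedTypes known (a ⊕ b))) (λ a b c d → (a ⊕ b) ≟ₛ (c ⊕ d))

movesᵇ : Vec Bool 12 → Solution → Bool
movesᵇ m sol = isYes (m ≟ₛ movedMask (Solution.moved sol))

equationᵇ : Vec Bool 12 → Solution → Bool
equationᵇ m (solution _ w y₁′ y₂′ y₃′ z₁′ z₂′ z₃′) =
  equalᵇ (map (shiftTerm w) (splitFormal m)) (formalForm y₁′ y₂′ y₃′ z₁′ z₂′ z₃′)

conditionsᵇ : Solution → Bool
conditionsᵇ (solution _ _ y₁′ y₂′ y₃′ z₁′ z₂′ z₃′) = isYes (conditions? y₁′ y₂′ y₃′ z₁′ z₂′ z₃′)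

solvesᵇ : Vec Bool 12 → Solution → Bool
solvesᵇ m sol = movesᵇ m sol ∧ equationᵇ m sol ∧ conditionsᵇ sol

-- `moved` lists the blocks that go to x_s P′; the other fields are W, Y′ and Z′.
certificate : List Solution
certificate =
  solution [] ∅ y₁ y₂ y₃ z₁ z₂ z₃ ∷
  solution (z₁ ∷ z₂ ∷ y₁ ∷ y₂ ∷ [])
    (y₃ ⊕ z₁) z₁ z₂ (y₃ ⊕ z₃) (y₁ ⊕ z₁) (y₁ ⊕ z₂) (y₃ ⊕ σ) ∷
  solution ((y₁ ⊕ y₃) ∷ (y₂ ⊕ y₃) ∷ y₃ ∷ (y₁ ⊕ (y₂ ⊕ y₃)) ∷ [])
    ∅ y₁ y₂ (y₃ ⊕ σ) z₁ z₂ z₃ ∷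
  solution ((y₁ ⊕ y₃) ∷ (y₂ ⊕ y₃) ∷ z₁ ∷ z₂ ∷ y₁ ∷ y₂ ∷ y₃ ∷ (y₁ ⊕ (y₂ ⊕ y₃)) ∷ [])
    (y₁ ⊕ z₃) (y₁ ⊕ z₁) (y₁ ⊕ z₂) (z₃ ⊕ σ) y₁ y₂ (y₃ ⊕ (z₃ ⊕ σ)) ∷
  solution ((y₁ ⊕ y₃) ∷ z₁ ∷ z₃ ∷ y₁ ∷ y₃ ∷ (z₁ ⊕ z₃) ∷ [])
    (y₁ ⊕ y₂) y₁ (y₂ ⊕ σ) y₃ z₁ (z₂ ⊕ σ) z₃ ∷
  solution ((y₂ ⊕ y₃) ∷ z₁ ∷ z₃ ∷ y₂ ∷ y₃ ∷ (z₁ ⊕ z₃) ∷ [])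
    (y₁ ⊕ y₂) y₂ (y₁ ⊕ σ) y₃ z₁ (z₂ ⊕ σ) z₃ ∷
  solution ((y₁ ⊕ y₃) ∷ z₁ ∷ (z₁ ⊕ (z₂ ⊕ z₃)) ∷ y₁ ∷ (y₁ ⊕ (y₂ ⊕ y₃)) ∷ (z₁ ⊕ z₃) ∷ [])
    ∅ y₂ (y₁ ⊕ σ) y₃ z₂ (z₁ ⊕ σ) z₃ ∷
  solution ((y₂ ⊕ y₃) ∷ z₁ ∷ (z₁ ⊕ (z₂ ⊕ z₃)) ∷ y₂ ∷ (y₁ ⊕ (y₂ ⊕ y₃)) ∷ (z₁ ⊕ z₃) ∷ [])
    ∅ y₁ (y₂ ⊕ σ) y₃ z₂ (z₁ ⊕ σ) z₃ ∷
  solution ((y₁ ⊕ y₃) ∷ z₂ ∷ z₃ ∷ y₁ ∷ y₃ ∷ (z₂ ⊕ z₃) ∷ [])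
    (y₁ ⊕ y₂) y₁ (y₂ ⊕ σ) y₃ z₂ (z₁ ⊕ σ) z₃ ∷
  solution ((y₂ ⊕ y₃) ∷ z₂ ∷ z₃ ∷ y₂ ∷ y₃ ∷ (z₂ ⊕ z₃) ∷ [])
    (y₁ ⊕ y₂) y₂ (y₁ ⊕ σ) y₃ z₂ (z₁ ⊕ σ) z₃ ∷
  solution ((y₁ ⊕ y₃) ∷ z₂ ∷ (z₁ ⊕ (z₂ ⊕ z₃)) ∷ y₁ ∷ (y₁ ⊕ (y₂ ⊕ y₃)) ∷ (z₂ ⊕ z₃) ∷ [])
    ∅ y₂ (y₁ ⊕ σ) y₃ z₁ (z₂ ⊕ σ) z₃ ∷
  solution ((y₂ ⊕ y₃) ∷ z₂ ∷ (z₁ ⊕ (z₂ ⊕ z₃)) ∷ y₂ ∷ (y₁ ⊕ (y₂ ⊕ y₃)) ∷ (z₂ ⊕ z₃) ∷ [])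
    ∅ y₁ (y₂ ⊕ σ) y₃ z₁ (z₂ ⊕ σ) z₃ ∷
  solution (z₃ ∷ (z₁ ⊕ (z₂ ⊕ z₃)) ∷ (z₁ ⊕ z₃) ∷ (z₂ ⊕ z₃) ∷ [])
    ∅ y₁ y₂ y₃ z₁ z₂ (z₃ ⊕ σ) ∷
  solution (z₁ ∷ z₂ ∷ z₃ ∷ (z₁ ⊕ (z₂ ⊕ z₃)) ∷ y₁ ∷ y₂ ∷ (z₁ ⊕ z₃) ∷ (z₂ ⊕ z₃) ∷ [])
    (y₃ ⊕ z₁) z₁ z₂ (y₃ ⊕ (z₃ ⊕ σ)) (y₁ ⊕ z₁) (y₁ ⊕ z₂) (y₃ ⊕ σ) ∷
  solution ((y₁ ⊕ y₃) ∷ (y₂ ⊕ y₃) ∷ z₃ ∷ (z₁ ⊕ (z₂ ⊕ z₃)) ∷ y₃ ∷ (y₁ ⊕ (y₂ ⊕ y₃)) ∷ (z₁ ⊕ z₃) ∷ (z₂ ⊕ z₃) ∷ [])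
    ∅ y₁ y₂ (y₃ ⊕ σ) z₁ z₂ (z₃ ⊕ σ) ∷
  solution blockSets σ y₁ y₂ y₃ z₁ z₂ z₃ ∷ []

by-evaluation : ∀ {b} → b ≡ true → T b
by-evaluation = Equivalence.from T-≡

blocks-expansion : T (equalᵇ (formalForm y₁ y₂ y₃ z₁ z₂ z₃) (Vec.toList blocks))
blocks-expansion = by-evaluation refl

blocks-units : All (λ q → proj₁ q ≡ + 1 ⊎ proj₁ q ≡ -[1+ 0 ]) (Vec.toList blocks)
blocks-units =
  toWitness {a? = All.all? (λ q → (proj₁ q ℤ.≟ + 1) ⊎-dec (proj₁ q ℤ.≟ -[1+ 0 ])) _} (by-evaluation refl)

family-covered : ∀ᵇ 6 (λ p → not (separatedBy familyPairs p) ∨ isYes (p ∈ₗ? familyTypes)) ≡ true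
family-covered = refl

extended-covered :
  ∀ᵇ 6 (λ p → not (separatedBy (familyPairs ++ avoidancePairs) p) ∨ isYes (p ∈ₗ? extendedTypes)) ≡ true
extended-covered = refl

blocks-distinct : AllPairs (λ a b → T (nonemptyᵇ familyTypes known (a ⊕ b))) blockSets
blocks-distinct =
  toWitness {a? = allPairs? (λ a b → T? (nonemptyᵇ familyTypes known (a ⊕ b))) blockSets} (by-evaluation refl)

generators-in-blocks : All (λ ab → proj₁ ab ≡ σ × proj₂ ab ∈ₗ blockSets) avoidancePairs
generators-in-blocks =
  toWitness {a? = All.all? (λ ab → (proj₁ ab ≟ₛ σ) ×-dec (proj₂ ab ∈ₗ? blockSets)) _} (by-evaluation refl)

validRegionᵇ : Sym × Sym × Sym → Bool
validRegionᵇ (g , R₁ , R₂) = regionᵇ extendedTypes g R₁ R₂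

regions-valid : All (T ∘ validRegionᵇ) regions
regions-valid = all⁺ _ regions (by-evaluation refl)

σ-region : T (regionᵇ extendedTypes σ σ σ)
σ-region = by-evaluation refl

-- Stated with ≡ rather than T: checking a term against T b makes Agda normalise b with its
-- slow reducer, which is prohibitive here.
certified : Vec Bool 12 → Bool
certified m = not (admissibleᵇ m) ∨ any (solvesᵇ m) certificate

certificate-complete : ∀ᵇ 12 certified ≡ true
certificate-complete = refl

IsShiftOfForm : ∀ {n} → GR n → Set
IsShiftOfForm {n} T′ =
  Σ (Subset n) λ W →
  Σ (Subset n) λ Y₁′ → Σ (Subset n) λ Y₂′ → Σ (Subset n) λ Y₃′ →
  Σ (Subset n) λ Z₁′ → Σ (Subset n) λ Z₂′ → Σ (Subset n) λ Z₃′ →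
    (shift W T′ ≈ form Y₁′ Y₂′ Y₃′ Z₁′ Z₂′ Z₃′) × FormConditions Y₁′ Y₂′ Y₃′ Z₁′ Z₂′ Z₃′

unit-bounds : ∀ {c} → c ≡ + 1 ⊎ c ≡ -[1+ 0 ] → pos c ≤ 1 × neg c ≤ 1
unit-bounds (inj₁ refl) = ℕₚ.≤-refl , ℕ.z≤n
unit-bounds (inj₂ refl) = ℕ.z≤n , ℕₚ.≤-refl

module Configuration {n : ℕ} {Y₁ Y₂ Y₃ Z₁ Z₂ Z₃ : Subset n} (s : Fin n)
  (conditions : FormConditions Y₁ Y₂ Y₃ Z₁ Z₂ Z₃) where

  open Symbolic (Y₁ ∷ Y₂ ∷ Y₃ ∷ Z₁ ∷ Z₃ ∷ ⁅ s ⁆ ∷ [])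

  ⟪σ⟫ : ⟪ σ ⟫ ≡ ⁅ s ⁆
  ⟪σ⟫ = ⊕-identityʳ ⁅ s ⁆

  as-generators : (P : (A₁ A₂ A₃ B₁ B₂ B₃ : Subset n) → Set) →
    P Y₁ Y₂ Y₃ Z₁ Z₂ Z₃ → P ⟪ y₁ ⟫ ⟪ y₂ ⟫ ⟪ y₃ ⟫ ⟪ z₁ ⟫ ⟪ z₂ ⟫ ⟪ z₃ ⟫
  as-generators P p =
    transport (⊕-identityʳ Y₁) (⊕-identityʳ Y₂) (⊕-identityʳ Y₃) (⊕-identityʳ Z₁) ⟪z₂⟫ (⊕-identityʳ Z₃)
    where
    ⟪z₂⟫ : ⟪ z₂ ⟫ ≡ Z₂
    ⟪z₂⟫ = let _ , _ , _ , _ , _ , Y₁⊕Y₂≡Z₁⊕Z₂ = conditions in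
      trans (cong (λ A → Y₁ ⊕ (Y₂ ⊕ A)) (⊕-identityʳ Z₁)) (⊕-transpose Y₁⊕Y₂≡Z₁⊕Z₂)
    transport : ∀ {A₁ A₂ A₃ B₁ B₂ B₃} → A₁ ≡ Y₁ → A₂ ≡ Y₂ → A₃ ≡ Y₃ → B₁ ≡ Z₁ → B₂ ≡ Z₂ → B₃ ≡ Z₃ →
      P A₁ A₂ A₃ B₁ B₂ B₃
    transport refl refl refl refl refl refl = p

  family-disjoint : All (λ ab → Disjoint ⟪ proj₁ ab ⟫ ⟪ proj₂ ab ⟫) familyPairs
  family-disjoint with as-generators FormConditions conditions
  ... | (d₁ , d₂ , d₃) , _ , (d₄ , d₅ , d₆) , _ = d₁ ∷ d₂ ∷ d₃ ∷ d₄ ∷ d₅ ∷ d₆ ∷ []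

  known-nonempty : All (Nonempty ∘ ⟪_⟫) known
  known-nonempty with as-generators FormConditions conditions
  ... | _ , (n₁ , n₂ , n₃) , _ , (n₄ , n₅ , n₆) ,
        (_ , _ , y₁≢z₁ , y₁≢z₂ , _ , _ , _ , _ , _ , _ , _ , y₃≢z₃ , _) , _ =
    n₁ ∷ n₂ ∷ n₃ ∷ n₄ ∷ n₅ ∷ n₆ ∷
    distinct {y₁} {z₁} y₁≢z₁ ∷ distinct {y₁} {z₂} y₁≢z₂ ∷ distinct {y₃} {z₃} y₃≢z₃ ∷
    (s , subst (s ∈_) (sym ⟪σ⟫) (x∈⁅x⁆ s)) ∷ []
    where
    distinct : ∀ {a b} → ⟪ a ⟫ ≢ ⟪ b ⟫ → Nonempty ⟪ a ⊕ b ⟫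
    distinct {a} {b} a≢b = subst Nonempty (sym (⟪⟫-⊕ a b)) (≢⇒nonempty-⊕ _ _ a≢b)

  open Typed familyTypes (separated-types familyPairs familyTypes family-covered family-disjoint)
    using () renaming (nonemptyᵇ-sound to family-nonemptyᵇ-sound)

  supports : List (Subset n)
  supports = map ⟪_⟫ blockSets

  supports-unique : Unique supports
  supports-unique = AllPairsₚ.map⁺ {f = ⟪_⟫} (AllPairs.map (λ {a} {b} → distinct {a} {b}) blocks-distinct)
    where
    distinct : ∀ {a b} → T (nonemptyᵇ familyTypes known (a ⊕ b)) → ⟪ a ⟫ ≢ ⟪ b ⟫
    distinct {a} {b} holds =
      nonempty-⊕⇒≢ (subst Nonempty (⟪⟫-⊕ a b) (family-nonemptyᵇ-sound {known} {a ⊕ b} known-nonempty holds))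

  module Trade {T₀ : GR n} (T₀≈form : T₀ ≈ form Y₁ Y₂ Y₃ Z₁ Z₂ Z₃) (s∉T₀ : Avoids s T₀) where

    T₀≈blocks : T₀ ≈ ⟦ realise (Vec.toList blocks) ⟧
    T₀≈blocks X = begin
      T₀ X
        ≡⟨ as-generators (λ A₁ A₂ A₃ B₁ B₂ B₃ → T₀ ≈ form A₁ A₂ A₃ B₁ B₂ B₃) T₀≈form X ⟩
      form ⟪ y₁ ⟫ ⟪ y₂ ⟫ ⟪ y₃ ⟫ ⟪ z₁ ⟫ ⟪ z₂ ⟫ ⟪ z₃ ⟫ X   ≡⟨ form≈⟦formalForm⟧ _ _ _ _ _ _ X ⟩
      ⟦ formalForm ⟪ y₁ ⟫ ⟪ y₂ ⟫ ⟪ y₃ ⟫ ⟪ z₁ ⟫ ⟪ z₂ ⟫ ⟪ z₃ ⟫ ⟧ X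
        ≡⟨ cong (λ L → ⟦ L ⟧ X) (realise-formalForm y₁ y₂ y₃ z₁ z₂ z₃) ⟨
      ⟦ realise (formalForm y₁ y₂ y₃ z₁ z₂ z₃) ⟧ X
        ≡⟨ ⟦realise⟧-cong {formalForm y₁ y₂ y₃ z₁ z₂ z₃} {Vec.toList blocks}
             (equalᵇ-sound (formalForm y₁ y₂ y₃ z₁ z₂ z₃) (Vec.toList blocks) blocks-expansion) X ⟩
      ⟦ realise (Vec.toList blocks) ⟧ X               ∎
      where open ≡-Reasoning

    T₀-on-block : ∀ {c g} → (c , g) ∈ₗ Vec.toList blocks → T₀ ⟪ g ⟫ ≡ c
    T₀-on-block {g = g} cg∈ =
      trans (T₀≈blocks ⟪ g ⟫) (⟦⟧-∈ (realise (Vec.toList blocks)) supports-unique (∈-map⁺ realiseTerm cg∈))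

    T₀-off-blocks : ∀ {X} → X ∉ₗ supports → T₀ X ≡ + 0
    T₀-off-blocks {X} X∉ = trans (T₀≈blocks X) (⟦⟧-∉ (realise (Vec.toList blocks)) X∉)

    s∉blocks : ∀ {g} → g ∈ₗ blockSets → ¬ s ∈ ⟪ g ⟫
    s∉blocks g∈ s∈ with ∈-map⁻ proj₂ g∈
    ... | (c , g) , cg∈ , refl with All.lookup blocks-units cg∈
    ...   | inj₁ c≡1  = contradiction (trans (sym (s∉T₀ _ s∈)) (trans (T₀-on-block cg∈) c≡1)) λ ()
    ...   | inj₂ c≡-1 = contradiction (trans (sym (s∉T₀ _ s∈)) (trans (T₀-on-block cg∈) c≡-1)) λ ()

    avoidance-disjoint : All (λ ab → Disjoint ⟪ proj₁ ab ⟫ ⟪ proj₂ ab ⟫) avoidancePairs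
    avoidance-disjoint = All.map avoided generators-in-blocks
      where
      avoided : ∀ {ab} → proj₁ ab ≡ σ × proj₂ ab ∈ₗ blockSets → Disjoint ⟪ proj₁ ab ⟫ ⟪ proj₂ ab ⟫
      avoided {.σ , g} (refl , g∈) = subst (λ A → Disjoint A ⟪ g ⟫) (sym ⟪σ⟫) (⁅⁆-disjoint (s∉blocks g∈))

    open Typed extendedTypes
      (separated-types (familyPairs ++ avoidancePairs) extendedTypes extended-covered
                       (Allₚ.++⁺ family-disjoint avoidance-disjoint))
      public

    type-s : type s ≡ σ
    type-s = Sum.reduce (regionᵇ-sound {σ} {σ} {σ} σ-region (subst (s ∈_) (sym ⟪σ⟫) (x∈⁅x⁆ s)))

    lookup-⟪⟫-s : ∀ g → lookup ⟪ g ⟫ s ≡ g · σ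
    lookup-⟪⟫-s g = trans (lookup-⟪⟫ g s) (cong (g ·_) type-s)

    conditions-sound : ∀ y₁′ y₂′ y₃′ z₁′ z₂′ z₃′ → T (isYes (conditions? y₁′ y₂′ y₃′ z₁′ z₂′ z₃′)) →
      FormConditions ⟪ y₁′ ⟫ ⟪ y₂′ ⟫ ⟪ y₃′ ⟫ ⟪ z₁′ ⟫ ⟪ z₂′ ⟫ ⟪ z₃′ ⟫
    conditions-sound y₁′ y₂′ y₃′ z₁′ z₂′ z₃′ holds =
      Conditions-map {Disj′ = Disjoint} {Nonempty} {λ A B → ¬ A ≡ B} {λ A B C D → A ⊕ B ≡ C ⊕ D} ⟪_⟫
        (λ {a} {b} → disjointᵇ-sound {a} {b}) (λ {a} → nonemptyᵇ-sound {known} {a} known-nonempty)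
        (λ {a} {b} → distinct {a} {b}) (λ {a} {b} {c} {d} → same-sum {a} {b} {c} {d})
        (toWitness {a? = conditions? y₁′ y₂′ y₃′ z₁′ z₂′ z₃′} holds)
      where
      distinct : ∀ {a b} → T (nonemptyᵇ extendedTypes known (a ⊕ b)) → ⟪ a ⟫ ≢ ⟪ b ⟫
      distinct {a} {b} holds =
        nonempty-⊕⇒≢ (subst Nonempty (⟪⟫-⊕ a b) (nonemptyᵇ-sound {known} {a ⊕ b} known-nonempty holds))

      same-sum : ∀ {a b c d} → a ⊕ b ≡ c ⊕ d → ⟪ a ⟫ ⊕ ⟪ b ⟫ ≡ ⟪ c ⟫ ⊕ ⟪ d ⟫
      same-sum {a} {b} {c} {d} eq = trans (sym (⟪⟫-⊕ a b)) (trans (cong ⟪_⟫ eq) (⟪⟫-⊕ c d))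

    equation-sound : ∀ {T′ : GR n} {L : Formal 6} w y₁′ y₂′ y₃′ z₁′ z₂′ z₃′ → T′ ≈ ⟦ realise L ⟧ →
      T (equalᵇ (map (shiftTerm w) L) (formalForm y₁′ y₂′ y₃′ z₁′ z₂′ z₃′)) →
      shift ⟪ w ⟫ T′ ≈ form ⟪ y₁′ ⟫ ⟪ y₂′ ⟫ ⟪ y₃′ ⟫ ⟪ z₁′ ⟫ ⟪ z₂′ ⟫ ⟪ z₃′ ⟫
    equation-sound {T′} {L} w y₁′ y₂′ y₃′ z₁′ z₂′ z₃′ T′≈L holds X = begin
      T′ (⟪ w ⟫ ⊕ X)                                   ≡⟨ T′≈L (⟪ w ⟫ ⊕ X) ⟩
      ⟦ realise L ⟧ (⟪ w ⟫ ⊕ X)                        ≡⟨ ⟦⟧-shift ⟪ w ⟫ (realise L) X ⟩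
      ⟦ map (shiftTerm ⟪ w ⟫) (realise L) ⟧ X          ≡⟨ cong (λ K → ⟦ K ⟧ X) (realise-shift w L) ⟨
      ⟦ realise (map (shiftTerm w) L) ⟧ X              ≡⟨ ⟦realise⟧-cong {map (shiftTerm w) L} {Form′}
                                                            (equalᵇ-sound (map (shiftTerm w) L) Form′ holds) X ⟩
      ⟦ realise Form′ ⟧ X
        ≡⟨ cong (λ K → ⟦ K ⟧ X) (realise-formalForm y₁′ y₂′ y₃′ z₁′ z₂′ z₃′) ⟩
      ⟦ formalForm ⟪ y₁′ ⟫ ⟪ y₂′ ⟫ ⟪ y₃′ ⟫ ⟪ z₁′ ⟫ ⟪ z₂′ ⟫ ⟪ z₃′ ⟫ ⟧ X ≡⟨ form≈⟦formalForm⟧ _ _ _ _ _ _ X ⟨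
      form ⟪ y₁′ ⟫ ⟪ y₂′ ⟫ ⟪ y₃′ ⟫ ⟪ z₁′ ⟫ ⟪ z₂′ ⟫ ⟪ z₃′ ⟫ X ∎
      where
      open ≡-Reasoning
      Form′ : Formal 6
      Form′ = formalForm y₁′ y₂′ y₃′ z₁′ z₂′ z₃′

    solution-sound : ∀ {T′ : GR n} m sol → T′ ≈ ⟦ realise (splitFormal m) ⟧ → T (solvesᵇ m sol) →
      IsShiftOfForm T′
    solution-sound m sol@(solution _ w y₁′ y₂′ y₃′ z₁′ z₂′ z₃′) T′≈split solved =
      let _ , equation , conditions′ = checks in
      ⟪ w ⟫ , ⟪ y₁′ ⟫ , ⟪ y₂′ ⟫ , ⟪ y₃′ ⟫ , ⟪ z₁′ ⟫ , ⟪ z₂′ ⟫ , ⟪ z₃′ ⟫ ,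
      equation-sound {L = splitFormal m} w y₁′ y₂′ y₃′ z₁′ z₂′ z₃′ T′≈split equation ,
      conditions-sound y₁′ y₂′ y₃′ z₁′ z₂′ z₃′ conditions′
      where
      checks : T (movesᵇ m sol) × T (equationᵇ m sol) × T (conditionsᵇ sol)
      checks = Product.map₂ (Equivalence.to (T-∧ {equationᵇ m sol}))
                            (Equivalence.to (T-∧ {movesᵇ m sol}) solved)

    module Realised {T′ : GR n} (m : Vec Bool 12) (T′≈split : T′ ≈ ⟦ realise (splitFormal m) ⟧)
                    (T′-trade : IsTrade 2 T′) where

      pairSum-vanishes : ∀ i → pairSum (splitFormal m) (type i) ≡ + 0
      pairSum-vanishes i = begin
        ⟨ splitFormal m ∣ (λ g → 𝟙ᵇ ((g · σ) ∧ (g · type i))) ⟩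
          ≡⟨ Sumℤ.sum-cong (splitFormal m) (λ q → cong (proj₁ q ℤ.*_) (indicator (proj₂ q))) ⟩
        ⟨ splitFormal m ∣ (λ g → 𝟙[ I ⊆ ⟪ g ⟫ ]) ⟩
          ≡⟨ ⟨realise∣⟩ (splitFormal m) 𝟙[ I ⊆_] ⟨
        ⟨ realise (splitFormal m) ∣ 𝟙[ I ⊆_] ⟩
          ≡⟨ sumSubsets-⟦⟧* (realise (splitFormal m)) 𝟙[ I ⊆_] ⟨
        Σℤ (λ X → ⟦ realise (splitFormal m) ⟧ X ℤ.* 𝟙[ I ⊆ X ])
          ≡⟨ Sumℤ.sum-cong (allSubsets n) (λ X → cong (ℤ._* 𝟙[ I ⊆ X ]) (T′≈split X)) ⟨
        Σℤ (λ X → T′ X ℤ.* 𝟙[ I ⊆ X ])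
          ≡⟨ weighted-count T′ I (T′-trade I (∣pair∣≤2 s i)) ⟩
        + 0 ∎
        where
        open ≡-Reasoning
        I : Subset n
        I = ⁅ s ⁆ ∪ ⁅ i ⁆
        indicator : ∀ g → 𝟙ᵇ ((g · σ) ∧ (g · type i)) ≡ 𝟙[ I ⊆ ⟪ g ⟫ ]
        indicator g =
          sym (trans (𝟙[pair⊆] s i ⟪ g ⟫) (cong₂ (λ a b → 𝟙ᵇ (a ∧ b)) (lookup-⟪⟫-s g) (lookup-⟪⟫ g i)))

      admissible : T (admissibleᵇ m)
      admissible = all⁻ (someVanishesᵇ m)
        (All.zipWith (λ {r} → region-vanishes {r}) (Allₚ.map⁻ {f = proj₁} known-nonempty , regions-valid))
        where
        region-vanishes : ∀ {r : Sym × Sym × Sym} → Nonempty ⟪ proj₁ r ⟫ × T (validRegionᵇ r) → T (someVanishesᵇ m r)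
        region-vanishes {g , R₁ , R₂} ((i , i∈g) , valid) = Equivalence.from T-∨
          (Sum.map (vanishes-at i) (vanishes-at i) (regionᵇ-sound {g} {R₁} {R₂} valid i∈g))
          where
          vanishes-at : ∀ i {R} → type i ≡ R → T (vanishesᵇ m R)
          vanishes-at i refl = fromWitness (pairSum-vanishes i)

      solvable : T (any (solvesᵇ m) certificate)
      solvable =
        implication {admissibleᵇ m} (Equivalence.from T-≡ (∀ᵇ-sound 12 certified certificate-complete m)) admissible

      shift-of-form : IsShiftOfForm T′
      shift-of-form =
        let sol , solved = Any.satisfied (any⁻ (solvesᵇ m) certificate solvable)
        in solution-sound m sol T′≈split solved

    module Split {T′ P P′ : GR n} (noCancel : ∀ X → NoCancellation (P X) (P′ X))
                 (T₀≈P+P′ : T₀ ≈ (P +ᴳ P′)) (T′≈ : T′ ≈ (P +ᴳ shift x[ s ] P′)) where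

      parts-off-blocks : ∀ {X} → X ∉ₗ supports → P X ≡ + 0 × P′ X ≡ + 0
      parts-off-blocks {X} X∉ = noCancellation-zero (noCancel X) (trans (sym (T₀≈P+P′ X)) (T₀-off-blocks X∉))

      P≈ : P ≈ ⟦ P on supports ⟧
      P≈ = expansion P supports supports-unique (λ X X∉ → proj₁ (parts-off-blocks X∉))

      P′≈ : P′ ≈ ⟦ P′ on supports ⟧
      P′≈ = expansion P′ supports supports-unique (λ X X∉ → proj₂ (parts-off-blocks X∉))

      side : ℤ × Sym → Bool
      side (c , g) = isYes (P ⟪ g ⟫ ℤ.≟ + 0)

      m : Vec Bool 12
      m = Vec.map side blocks

      block-parts : ∀ {c g} → (c , g) ∈ₗ Vec.toList blocks →
        P ⟪ g ⟫ ≡ (if side (c , g) then + 0 else c) × P′ ⟪ g ⟫ ≡ (if side (c , g) then c else + 0)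
      block-parts {c} {g} cg∈ = split-at-zero P+P′≡c
        (noCancellation-unit _ _ (noCancel ⟪ g ⟫) P+P′≡c (proj₁ c-unit) (proj₂ c-unit))
        where
        P+P′≡c : P ⟪ g ⟫ ℤ.+ P′ ⟪ g ⟫ ≡ c
        P+P′≡c = trans (sym (T₀≈P+P′ ⟪ g ⟫)) (T₀-on-block cg∈)
        c-unit : pos c ≤ 1 × neg c ≤ 1
        c-unit = unit-bounds (All.lookup blocks-units cg∈)

      kept : realise (Vec.toList (Vec.zipWith keepTerm m blocks)) ≡ P on supports
      kept = map-cong-local {f = λ q → realiseTerm (keepTerm (side q) q)}
                            {g = λ q → P ⟪ proj₂ q ⟫ , ⟪ proj₂ q ⟫}
        (All.tabulate λ { {c , g} cg∈ → cong (_, ⟪ g ⟫) (sym (proj₁ (block-parts cg∈))) })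

      moved : realise (Vec.toList (Vec.zipWith moveTerm m blocks)) ≡ map (shiftTerm x[ s ]) (P′ on supports)
      moved = map-cong-local {f = λ q → realiseTerm (moveTerm (side q) q)}
                             {g = λ q → shiftTerm x[ s ] (P′ ⟪ proj₂ q ⟫ , ⟪ proj₂ q ⟫)}
        (All.tabulate λ { {c , g} cg∈ → cong₂ _,_ (sym (proj₂ (block-parts cg∈)))
                                                  (trans (⟪⟫-⊕ σ g) (cong (_⊕ ⟪ g ⟫) ⟪σ⟫)) })

      T′≈split : T′ ≈ ⟦ realise (splitFormal m) ⟧
      T′≈split X = begin
        T′ X                                                               ≡⟨ T′≈ X ⟩
        P X ℤ.+ P′ (x[ s ] ⊕ X)                                   ≡⟨ cong₂ ℤ._+_ (P≈ X) (P′≈ (x[ s ] ⊕ X)) ⟩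
        ⟦ P on supports ⟧ X ℤ.+ ⟦ P′ on supports ⟧ (x[ s ] ⊕ X)
          ≡⟨ cong (λ z → ⟦ P on supports ⟧ X ℤ.+ z) (⟦⟧-shift x[ s ] (P′ on supports) X) ⟩
        ⟦ P on supports ⟧ X ℤ.+ ⟦ map (shiftTerm x[ s ]) (P′ on supports) ⟧ X
          ≡⟨ ⟨⟩-++ (P on supports) (map (shiftTerm x[ s ]) (P′ on supports)) (λ B → δ B X) ⟨
        ⟦ P on supports ++ map (shiftTerm x[ s ]) (P′ on supports) ⟧ X
          ≡⟨ cong (λ L → ⟦ L ⟧ X) (cong₂ _++_ kept moved) ⟨
        ⟦ realise (splitFormal m) ⟧ X                                      ∎
        where open ≡-Reasoning


proposition6p3 : (n : ℕ) (T : GR n) (Y₁ Y₂ Y₃ Z₁ Z₂ Z₃ : Subset n) →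
    IsTrade 2 T → vol T ≡ 6 →
    T ≈ form Y₁ Y₂ Y₃ Z₁ Z₂ Z₃ →
    FormConditions Y₁ Y₂ Y₃ Z₁ Z₂ Z₃ →
    (T' : GR n) → IsExtension 2 T T' →
    Σ (Subset n) λ W →
    Σ (Subset n) λ Y₁' → Σ (Subset n) λ Y₂' → Σ (Subset n) λ Y₃' →
    Σ (Subset n) λ Z₁' → Σ (Subset n) λ Z₂' → Σ (Subset n) λ Z₃' →
      (shift W T' ≈ form Y₁' Y₂' Y₃' Z₁' Z₂' Z₃') × FormConditions Y₁' Y₂' Y₃' Z₁' Z₂' Z₃'
proposition6p3 n T Y₁ Y₂ Y₃ Z₁ Z₂ Z₃ T-trade _ T≈form conditions T′
  (T′-trade , (s , s∉T , P , P′ , s∉P , s∉P′ , T′≈ , T≈P+P′) , vol≡) =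
  -- The volume hypothesis (ignored above) follows from the form of T.
  Realised.shift-of-form m T′≈split T′-trade
  where
  open Configuration s conditions
  open Trade T≈form s∉T
  open Split {T′} {P} {P′} (extension-noCancellation T-trade T′-trade vol≡ s∉P s∉P′ T′≈ T≈P+P′) T≈P+P′ T′≈
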